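{- Let $a,b\in\mathbb{Z}$ with $a\le 0<b$ and $S_{a,b}=\conv\{(0,0,a),(0,0,b)\}$. Then the following are non-spanning lattice $3$-polytopes of width larger than one: (1) $\widetilde F_1(a,b)=\conv(S_{a,b}\cup\{(-1,-1,0),(2,-1,1),(-1,2,-1)\})$, of index $3$; (2) $\widetilde F_2(a,b)=\conv(S_{a,b}\cup\{(-1,-1,1),(1,-1,0),(-1,1,0)\})$, with $(a,b)\neq(0,1)$, of index $2$; (3) $\widetilde F_3(a,b,k)=\conv(S_{a,b}\cup\{(-1,-1,1),(1,-1,0),(-1,1,0),(1,1,2k-1)\})$, for any $k\in\{0,\dots,b\}$ with $(a,b,k)\neq(0,1,1)$, of index $2$; (4) $\widetilde F_4(a,b)=\conv(S_{a,b}\cup\{(-1,-1,1),(1,-1,0),(-1,1,0),(3,-1,-1)\})$, of index $2$.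
   Context: A lattice $3$-polytope is a polytope in $\mathbb{R}^3$ with vertices in $\mathbb{Z}^3$ and dimension $3$. Its width is the minimum of $\max f(P)-\min f(P)$ over non-constant affine functionals $f$ with $f(\mathbb{Z}^3)\subseteq\mathbb{Z}$. Its index is the index in $\mathbb{Z}^3$ of the affine lattice generated by $P\cap\mathbb{Z}^3$ (integer affine combinations); non-spanning means index $>1$. -}

module Defs where

open import Data.Nat using (ℕ; zero; suc)
open import Data.Fin using (Fin; zero; suc)
open import Data.Vec using (Vec; []; _∷_; lookup)
open import Data.Product using (Σ; ∃; _×_; _,_)
open import Relation.Binary.PropositionalEquality using (_≡_)
open import Relation.Nullary using (¬_)
open import Data.Integer as ℤ using (ℤ; +_; -[1+_])
open import Data.Rational as ℚ using (ℚ; 0ℚ; 1ℚ)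

PtZ : Set
PtZ = ℤ × ℤ × ℤ

PtQ : Set
PtQ = ℚ × ℚ × ℚ

infixl 6 _-Z_ _+Z_
_+Z_ : PtZ → PtZ → PtZ
(x , y , z) +Z (x' , y' , z') = (x ℤ.+ x') , (y ℤ.+ y') , (z ℤ.+ z')

_-Z_ : PtZ → PtZ → PtZ
(x , y , z) -Z (x' , y' , z') = (x ℤ.- x') , (y ℤ.- y') , (z ℤ.- z')

negZ : PtZ → PtZ
negZ (x , y , z) = ℤ.- x , ℤ.- y , ℤ.- z

0Z : PtZ
0Z = + 0 , + 0 , + 0

toQ : PtZ → PtQ
toQ (x , y , z) = (x ℚ./ 1) , (y ℚ./ 1) , (z ℚ./ 1)

_+Q_ : PtQ → PtQ → PtQ
(x , y , z) +Q (x' , y' , z') = (x ℚ.+ x') , (y ℚ.+ y') , (z ℚ.+ z')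

_-Q_ : PtQ → PtQ → PtQ
(x , y , z) -Q (x' , y' , z') = (x ℚ.- x') , (y ℚ.- y') , (z ℚ.- z')

scaleQ : ℚ → PtQ → PtQ
scaleQ c (x , y , z) = (c ℚ.* x) , (c ℚ.* y) , (c ℚ.* z)

0Q : PtQ
0Q = 0ℚ , 0ℚ , 0ℚ

dotQ : PtZ → PtQ → ℚ
dotQ (a , b , c) (x , y , z) =
  ((a ℚ./ 1) ℚ.* x) ℚ.+ ((b ℚ./ 1) ℚ.* y) ℚ.+ ((c ℚ./ 1) ℚ.* z)

det3 : PtQ → PtQ → PtQ → ℚ
det3 (a₁ , a₂ , a₃) (b₁ , b₂ , b₃) (c₁ , c₂ , c₃) =
  (a₁ ℚ.* ((b₂ ℚ.* c₃) ℚ.- (b₃ ℚ.* c₂)))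
  ℚ.- (a₂ ℚ.* ((b₁ ℚ.* c₃) ℚ.- (b₃ ℚ.* c₁)))
  ℚ.+ (a₃ ℚ.* ((b₁ ℚ.* c₂) ℚ.- (b₂ ℚ.* c₁)))

sumℚ : ∀ {n} → (Fin n → ℚ) → ℚ
sumℚ {zero} f = 0ℚ
sumℚ {suc n} f = f zero ℚ.+ sumℚ (λ i → f (suc i))

sumQ : ∀ {n} → (Fin n → PtQ) → PtQ
sumQ {zero} f = 0Q
sumQ {suc n} f = f zero +Q sumQ (λ i → f (suc i))

InConv : ∀ {n} → Vec PtZ n → PtQ → Set
InConv {n} vs x =
  Σ (Fin n → ℚ) λ λs →
    (∀ i → 0ℚ ℚ.≤ λs i) ×
    (sumℚ λs ≡ 1ℚ) ×
    (sumQ (λ i → scaleQ (λs i) (toQ (lookup vs i))) ≡ x)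

LatticePt : ∀ {n} → Vec PtZ n → PtZ → Set
LatticePt vs z = InConv vs (toQ z)

Dim3 : ∀ {n} → Vec PtZ n → Set
Dim3 vs = Σ PtQ λ p₀ → Σ PtQ λ p₁ → Σ PtQ λ p₂ → Σ PtQ λ p₃ →
  InConv vs p₀ × InConv vs p₁ × InConv vs p₂ × InConv vs p₃ ×
  ¬ (det3 (p₁ -Q p₀) (p₂ -Q p₀) (p₃ -Q p₀) ≡ 0ℚ)

-- width larger than one: for every non-constant integral affine functional
-- f(x) = c·x + d (c ∈ ℤ³∖{0}, d ∈ ℤ), max f(P) − min f(P) > 1, i.e. there
-- are points x, y of P with f(x) − f(y) > 1 (the constant d cancels).
WidthGT1 : ∀ {n} → Vec PtZ n → Set
WidthGT1 vs = ∀ (c : PtZ) → ¬ (c ≡ 0Z) →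
  Σ PtQ λ x → Σ PtQ λ y → InConv vs x × InConv vs y ×
    (1ℚ ℚ.< (dotQ c x ℚ.- dotQ c y))

-- the subgroup of ℤ³ generated by the differences of elements of S,
-- i.e. the linear lattice underlying the affine lattice generated by S
data DiffLattice (S : PtZ → Set) : PtZ → Set where
  diff : ∀ {u v} → S u → S v → DiffLattice S (u -Z v)
  zer  : DiffLattice S 0Z
  add  : ∀ {u v} → DiffLattice S u → DiffLattice S v → DiffLattice S (u +Z v)
  neg  : ∀ {u} → DiffLattice S u → DiffLattice S (negZ u)

-- the index of the affine lattice generated by S in ℤ³ is m:
-- ℤ³ / DiffLattice S has exactly m elements (explicit coset representatives)
HasIndex : (S : PtZ → Set) → ℕ → Set
HasIndex S m = Σ (Fin m → PtZ) λ rep →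
  (∀ i j → DiffLattice S (rep i -Z rep j) → i ≡ j) ×
  (∀ z → ∃ λ i → DiffLattice S (z -Z rep i))

Index : ∀ {n} → Vec PtZ n → ℕ → Set
Index vs m = HasIndex (LatticePt vs) m

-- non-spanning lattice 3-polytope of width > 1 and index m
-- (non-spanning: index > 1, i.e. m ≥ 2)
NonSpanningWide : ∀ {n} → Vec PtZ n → ℕ → Set
NonSpanningWide vs m = Dim3 vs × WidthGT1 vs × Index vs m × (2 Data.Nat.≤ m)

pt : ℤ → ℤ → ℤ → PtZ
pt x y z = x , y , z

-1ℤ : ℤ
-1ℤ = -[1+ 0 ]

F1 : ℤ → ℤ → Vec PtZ 5
F1 a b = pt (+ 0) (+ 0) a ∷ pt (+ 0) (+ 0) b ∷
  pt -1ℤ -1ℤ (+ 0) ∷ pt (+ 2) -1ℤ (+ 1) ∷ pt -1ℤ (+ 2) -1ℤ ∷ []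

F2 : ℤ → ℤ → Vec PtZ 5
F2 a b = pt (+ 0) (+ 0) a ∷ pt (+ 0) (+ 0) b ∷
  pt -1ℤ -1ℤ (+ 1) ∷ pt (+ 1) -1ℤ (+ 0) ∷ pt -1ℤ (+ 1) (+ 0) ∷ []

F3 : ℤ → ℤ → ℤ → Vec PtZ 6
F3 a b k = pt (+ 0) (+ 0) a ∷ pt (+ 0) (+ 0) b ∷
  pt -1ℤ -1ℤ (+ 1) ∷ pt (+ 1) -1ℤ (+ 0) ∷ pt -1ℤ (+ 1) (+ 0) ∷
  pt (+ 1) (+ 1) ((+ 2 ℤ.* k) ℤ.- + 1) ∷ []

F4 : ℤ → ℤ → Vec PtZ 6
F4 a b = pt (+ 0) (+ 0) a ∷ pt (+ 0) (+ 0) b ∷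
  pt -1ℤ -1ℤ (+ 1) ∷ pt (+ 1) -1ℤ (+ 0) ∷ pt -1ℤ (+ 1) (+ 0) ∷
  pt (+ 3) -1ℤ -1ℤ ∷ []

-- Everything is read off from integral affine functionals h.  If a point u of P = conv(vs)
-- has barycentric weights w, then h(u) = Σ wᵢ h(vᵢ): so h ≥ 0 on the vertices gives h(u) ≥ 0,
-- strictly as soon as some vertex with h > 0 has positive weight, and h(u) = 0 whenever h
-- vanishes at every vertex of positive weight.
--
-- For a lattice point u of F₁ either the axis segment S_{a,b} has positive weight, and
-- then x + 1, y + 1 and 1 − x − y are positive, forcing x = y = 0; or u lies in conv(A, B, C),
-- which is contained in the plane x − y = 3z.  Either way 3 divides x − y, and differences of
-- the lattice points (0,0,0), (0,0,1), A and B generate (1,1,0), (3,0,0) and (0,0,1), which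
-- span that sublattice of index 3.
-- F₂ and F₄ work alike with the plane x + y + 2z = 0 and 2 ∣ x + y.  In F₃ the vertices off
-- the axis are not coplanar; they lie over the corners of the square [−1,1]², and a lattice
-- point with x + y odd would lie on an edge joining two of them, at half-integral height.
--
-- Suppose c varies by at most one over the vertices.  The relation A + B + C = 0 of
-- F₁ (B + C = 0 for the others) forces c to vanish at these vertices, and then the axis
-- segment, of length b − a ≥ 1, forces c = 0.  For F₂, F₃, F₄ a second vertex relation is
-- needed when b − a = 1: A + D = 0 for F₃ with k = 0, and A + D = 2B for F₄.

module Submission where

open import Defs
open import Data.Empty using (⊥-elim)
open import Data.Fin using (Fin; zero; suc; #_; toℕ; fromℕ<)
import Data.Fin.Properties as Finₚ
open import Data.Integer as ℤ using (ℤ; +_; -[1+_]; ∣_∣; _≤_; _<_; +≤+; +<+)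
import Data.Integer.Properties as ℤₚ
open import Data.Integer.Divisibility.Signed using (_∣_; divides; ∣m∣n⇒∣m+n; ∣m∣n⇒∣m-n; ∣m⇒∣-m)
open import Data.Integer.DivMod using (a≡a%ℕn+[a/ℕn]*n; n%ℕd<d)
open import Data.Integer.Tactic.RingSolver using (solve-∀)
open import Data.Nat as ℕ using (zero; suc; z≤n; s≤s)
import Data.Nat.Properties as ℕₚ
open import Data.Nat.Coprimality using (1-coprimeTo) renaming (sym to coprime-sym)
open import Data.Product using (Σ; ∃; _×_; _,_; proj₁; proj₂)
open import Data.Rational as ℚ using (ℚ; mkℚ; 0ℚ; 1ℚ)
import Data.Rational.Properties as ℚₚ
open import Data.Rational.Solver using (module +-*-Solver)
open import Data.Sum as Sum using (_⊎_; inj₁; inj₂; [_,_]′)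
open import Data.Vec using (Vec; []; _∷_; lookup)
open import Function using (_∘_)
open import Relation.Binary.PropositionalEquality
open import Relation.Nullary using (¬_; yes; no)
open import Relation.Nullary.Decidable using (True; toWitness)

open +-*-Solver using (solve; _:=_; _:+_; _:*_; con)
open ≡-Reasoning


fromℤ : ℤ → ℚ
fromℤ z = z ℚ./ 1

private
  fromℤ≡mkℚ : ∀ z → fromℤ z ≡ mkℚ z 0 (coprime-sym (1-coprimeTo _))
  fromℤ≡mkℚ z = ℚₚ.↥p/↧p≡p (mkℚ z 0 _)

fromℤ-homo-+ : ∀ m n → fromℤ (m ℤ.+ n) ≡ fromℤ m ℚ.+ fromℤ n
fromℤ-homo-+ m n rewrite fromℤ≡mkℚ m | fromℤ≡mkℚ n | ℤₚ.*-identityʳ m | ℤₚ.*-identityʳ n = refl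

fromℤ-homo-* : ∀ m n → fromℤ (m ℤ.* n) ≡ fromℤ m ℚ.* fromℤ n
fromℤ-homo-* m n rewrite fromℤ≡mkℚ m | fromℤ≡mkℚ n = refl

fromℤ-homo-neg : ∀ m → fromℤ (ℤ.- m) ≡ ℚ.- fromℤ m
fromℤ-homo-neg (+ zero) = refl
fromℤ-homo-neg (+ suc n) rewrite fromℤ≡mkℚ (+ suc n) = refl
fromℤ-homo-neg -[1+ n ] rewrite fromℤ≡mkℚ (+ suc n) = refl

fromℤ-homo-- : ∀ m n → fromℤ (m ℤ.- n) ≡ fromℤ m ℚ.- fromℤ n
fromℤ-homo-- m n = trans (fromℤ-homo-+ m (ℤ.- n)) (cong (fromℤ m ℚ.+_) (fromℤ-homo-neg n))

fromℤ-injective : ∀ {m n} → fromℤ m ≡ fromℤ n → m ≡ n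
fromℤ-injective {m} {n} eq rewrite fromℤ≡mkℚ m | fromℤ≡mkℚ n = cong ℚ.↥_ eq

fromℤ-mono-≤ : ∀ {m n} → m ≤ n → fromℤ m ℚ.≤ fromℤ n
fromℤ-mono-≤ {m} {n} m≤n rewrite fromℤ≡mkℚ m | fromℤ≡mkℚ n =
  ℚ.*≤* (subst₂ _≤_ (sym (ℤₚ.*-identityʳ m)) (sym (ℤₚ.*-identityʳ n)) m≤n)

fromℤ-mono-< : ∀ {m n} → m < n → fromℤ m ℚ.< fromℤ n
fromℤ-mono-< {m} {n} m<n rewrite fromℤ≡mkℚ m | fromℤ≡mkℚ n =
  ℚ.*<* (subst₂ _<_ (sym (ℤₚ.*-identityʳ m)) (sym (ℤₚ.*-identityʳ n)) m<n)

fromℤ-cancel-≤ : ∀ {m n} → fromℤ m ℚ.≤ fromℤ n → m ≤ n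
fromℤ-cancel-≤ {m} {n} le rewrite fromℤ≡mkℚ m | fromℤ≡mkℚ n with le
... | ℚ.*≤* m≤n rewrite ℤₚ.*-identityʳ m | ℤₚ.*-identityʳ n = m≤n

fromℤ-cancel-< : ∀ {m n} → fromℤ m ℚ.< fromℤ n → m < n
fromℤ-cancel-< {m} {n} lt rewrite fromℤ≡mkℚ m | fromℤ≡mkℚ n with lt
... | ℚ.*<* m<n rewrite ℤₚ.*-identityʳ m | ℤₚ.*-identityʳ n = m<n

*-nonneg : ∀ {p q} → 0ℚ ℚ.≤ p → 0ℚ ℚ.≤ q → 0ℚ ℚ.≤ p ℚ.* q
*-nonneg {p} {q} p≥0 q≥0 =
  ℚₚ.nonNegative⁻¹ _ {{ℚₚ.nonNeg*nonNeg⇒nonNeg p {{ℚ.nonNegative p≥0}} q {{ℚ.nonNegative q≥0}}}}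

*-pos : ∀ {p q} → 0ℚ ℚ.< p → 0ℚ ℚ.< q → 0ℚ ℚ.< p ℚ.* q
*-pos {p} {q} p>0 q>0 =
  ℚₚ.positive⁻¹ _ {{ℚₚ.pos*pos⇒pos p {{ℚ.positive p>0}} q {{ℚ.positive q>0}}}}

module _ {d : ℤ} (0<d : + 0 < d) where

  private
    instance
      fromℤ-d≢0 : ℚ.NonZero (fromℤ d)
      fromℤ-d≢0 = ℚₚ.pos⇒nonZero (fromℤ d) {{ℚ.positive (fromℤ-mono-< 0<d)}}

  1/fromℤ : ℚ
  1/fromℤ = ℚ.1/ fromℤ d

  1/fromℤ-nonneg : 0ℚ ℚ.≤ 1/fromℤ
  1/fromℤ-nonneg = ℚₚ.<⇒≤ (ℚₚ.positive⁻¹ 1/fromℤ {{ℚₚ.1/pos⇒pos (fromℤ d) {{ℚ.positive (fromℤ-mono-< 0<d)}}}})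

  fromℤ-*-1/fromℤ : ∀ n → fromℤ (n ℤ.* d) ℚ.* 1/fromℤ ≡ fromℤ n
  fromℤ-*-1/fromℤ n = begin
    fromℤ (n ℤ.* d) ℚ.* 1/fromℤ        ≡⟨ cong (ℚ._* 1/fromℤ) (fromℤ-homo-* n d) ⟩
    fromℤ n ℚ.* fromℤ d ℚ.* 1/fromℤ    ≡⟨ ℚₚ.*-assoc (fromℤ n) (fromℤ d) 1/fromℤ ⟩
    fromℤ n ℚ.* (fromℤ d ℚ.* 1/fromℤ)  ≡⟨ cong (fromℤ n ℚ.*_) (ℚₚ.*-inverseʳ (fromℤ d)) ⟩
    fromℤ n ℚ.* 1ℚ                     ≡⟨ ℚₚ.*-identityʳ (fromℤ n) ⟩
    fromℤ n                            ∎

sumℚ-cong : ∀ {n} {f g : Fin n → ℚ} → (∀ i → f i ≡ g i) → sumℚ f ≡ sumℚ g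
sumℚ-cong {zero} f≡g = refl
sumℚ-cong {suc n} f≡g = cong₂ ℚ._+_ (f≡g zero) (sumℚ-cong (f≡g ∘ suc))

sumℚ-zero : ∀ {n} {f : Fin n → ℚ} → (∀ i → f i ≡ 0ℚ) → sumℚ f ≡ 0ℚ
sumℚ-zero {zero} f≡0 = refl
sumℚ-zero {suc n} f≡0 = cong₂ ℚ._+_ (f≡0 zero) (sumℚ-zero (f≡0 ∘ suc))

sumℚ-nonneg : ∀ {n} {f : Fin n → ℚ} → (∀ i → 0ℚ ℚ.≤ f i) → 0ℚ ℚ.≤ sumℚ f
sumℚ-nonneg {zero} f≥0 = ℚₚ.≤-refl
sumℚ-nonneg {suc n} f≥0 = ℚₚ.+-mono-≤ (f≥0 zero) (sumℚ-nonneg (f≥0 ∘ suc))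

sumℚ-pos : ∀ {n} {f : Fin n → ℚ} → (∀ i → 0ℚ ℚ.≤ f i) → ∀ j → 0ℚ ℚ.< f j → 0ℚ ℚ.< sumℚ f
sumℚ-pos f≥0 zero f₀>0 = ℚₚ.+-mono-<-≤ f₀>0 (sumℚ-nonneg (f≥0 ∘ suc))
sumℚ-pos f≥0 (suc j) fⱼ>0 = ℚₚ.+-mono-≤-< (f≥0 zero) (sumℚ-pos (f≥0 ∘ suc) j fⱼ>0)

sumℚ-*-distrib-+ : ∀ {n} (w f : Fin n → ℚ) e →
  sumℚ (λ i → w i ℚ.* f i) ℚ.+ sumℚ w ℚ.* e ≡ sumℚ (λ i → w i ℚ.* (f i ℚ.+ e))
sumℚ-*-distrib-+ {zero} w f e = solve 1 (λ e → con 0ℚ :+ con 0ℚ :* e := con 0ℚ) refl e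
sumℚ-*-distrib-+ {suc n} w f e = begin
  (w zero ℚ.* f zero ℚ.+ S) ℚ.+ (w zero ℚ.+ T) ℚ.* e
    ≡⟨ solve 5 (λ w₀ f₀ S T e → (w₀ :* f₀ :+ S) :+ (w₀ :+ T) :* e := w₀ :* (f₀ :+ e) :+ (S :+ T :* e))
         refl (w zero) (f zero) S T e ⟩
  w zero ℚ.* (f zero ℚ.+ e) ℚ.+ (S ℚ.+ T ℚ.* e)
    ≡⟨ cong (w zero ℚ.* (f zero ℚ.+ e) ℚ.+_) (sumℚ-*-distrib-+ (w ∘ suc) (f ∘ suc) e) ⟩
  sumℚ (λ i → w i ℚ.* (f i ℚ.+ e)) ∎
  where
  S = sumℚ (λ i → w (suc i) ℚ.* f (suc i))
  T = sumℚ (w ∘ suc)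


≡-triple : ∀ {A : Set} {a a′ b b′ c c′ : A} → a ≡ a′ → b ≡ b′ → c ≡ c′ →
           _≡_ {A = A × A × A} (a , b , c) (a′ , b′ , c′)
≡-triple a≡ b≡ c≡ = cong₂ _,_ a≡ (cong₂ _,_ b≡ c≡)

axis : ℤ → PtZ
axis t = pt (+ 0) (+ 0) t

infix 7 _·_
_·_ : PtZ → PtZ → ℤ
(c₁ , c₂ , c₃) · (x , y , z) = c₁ ℤ.* x ℤ.+ c₂ ℤ.* y ℤ.+ c₃ ℤ.* z

·-+Z : ∀ c u v → c · (u +Z v) ≡ c · u ℤ.+ c · v
·-+Z (c₁ , c₂ , c₃) (x , y , z) (x′ , y′ , z′) = lemma c₁ c₂ c₃ x y z x′ y′ z′
  where
  lemma : ∀ c₁ c₂ c₃ x y z x′ y′ z′ →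
    c₁ ℤ.* (x ℤ.+ x′) ℤ.+ c₂ ℤ.* (y ℤ.+ y′) ℤ.+ c₃ ℤ.* (z ℤ.+ z′)
    ≡ (c₁ ℤ.* x ℤ.+ c₂ ℤ.* y ℤ.+ c₃ ℤ.* z) ℤ.+ (c₁ ℤ.* x′ ℤ.+ c₂ ℤ.* y′ ℤ.+ c₃ ℤ.* z′)
  lemma = solve-∀

·--Z : ∀ c u v → c · (u -Z v) ≡ c · u ℤ.- c · v
·--Z (c₁ , c₂ , c₃) (x , y , z) (x′ , y′ , z′) = lemma c₁ c₂ c₃ x y z x′ y′ z′
  where
  lemma : ∀ c₁ c₂ c₃ x y z x′ y′ z′ →
    c₁ ℤ.* (x ℤ.- x′) ℤ.+ c₂ ℤ.* (y ℤ.- y′) ℤ.+ c₃ ℤ.* (z ℤ.- z′)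
    ≡ (c₁ ℤ.* x ℤ.+ c₂ ℤ.* y ℤ.+ c₃ ℤ.* z) ℤ.- (c₁ ℤ.* x′ ℤ.+ c₂ ℤ.* y′ ℤ.+ c₃ ℤ.* z′)
  lemma = solve-∀

·-negZ : ∀ c u → c · negZ u ≡ ℤ.- (c · u)
·-negZ (c₁ , c₂ , c₃) (x , y , z) = lemma c₁ c₂ c₃ x y z
  where
  lemma : ∀ c₁ c₂ c₃ x y z →
    c₁ ℤ.* ℤ.- x ℤ.+ c₂ ℤ.* ℤ.- y ℤ.+ c₃ ℤ.* ℤ.- z ≡ ℤ.- (c₁ ℤ.* x ℤ.+ c₂ ℤ.* y ℤ.+ c₃ ℤ.* z)
  lemma = solve-∀

·-0Z : ∀ c → c · 0Z ≡ + 0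
·-0Z (c₁ , c₂ , c₃) = lemma c₁ c₂ c₃
  where
  lemma : ∀ c₁ c₂ c₃ → c₁ ℤ.* + 0 ℤ.+ c₂ ℤ.* + 0 ℤ.+ c₃ ℤ.* + 0 ≡ + 0
  lemma = solve-∀

·-axis : ∀ c t → c · axis t ≡ proj₂ (proj₂ c) ℤ.* t
·-axis (c₁ , c₂ , c₃) t = lemma c₁ c₂ c₃ t
  where
  lemma : ∀ c₁ c₂ c₃ t → c₁ ℤ.* + 0 ℤ.+ c₂ ℤ.* + 0 ℤ.+ c₃ ℤ.* t ≡ c₃ ℤ.* t
  lemma = solve-∀

·-sum-zero₂ : ∀ c u v → u +Z v ≡ 0Z → c · u ℤ.+ c · v ≡ + 0
·-sum-zero₂ c u v u+v≡0 = trans (sym (·-+Z c u v)) (trans (cong (c ·_) u+v≡0) (·-0Z c))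

·-sum-zero₃ : ∀ c u v w → u +Z v +Z w ≡ 0Z → c · u ℤ.+ c · v ℤ.+ c · w ≡ + 0
·-sum-zero₃ c u v w u+v+w≡0 = trans (cong (ℤ._+ c · w) (sym (·-+Z c u v))) (·-sum-zero₂ c (u +Z v) w u+v+w≡0)

Affine : Set
Affine = PtZ × ℤ

_⟨_⟩ : Affine → PtZ → ℤ
(c , d) ⟨ u ⟩ = c · u ℤ.+ d


dotQ-+Q : ∀ c p q → dotQ c (p +Q q) ≡ dotQ c p ℚ.+ dotQ c q
dotQ-+Q (c₁ , c₂ , c₃) (p₁ , p₂ , p₃) (q₁ , q₂ , q₃) =
  solve 9 (λ a b c x y z x′ y′ z′ →
             a :* (x :+ x′) :+ b :* (y :+ y′) :+ c :* (z :+ z′)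
             := (a :* x :+ b :* y :+ c :* z) :+ (a :* x′ :+ b :* y′ :+ c :* z′))
    refl (fromℤ c₁) (fromℤ c₂) (fromℤ c₃) p₁ p₂ p₃ q₁ q₂ q₃

dotQ-scaleQ : ∀ c t p → dotQ c (scaleQ t p) ≡ t ℚ.* dotQ c p
dotQ-scaleQ (c₁ , c₂ , c₃) t (p₁ , p₂ , p₃) =
  solve 7 (λ a b c t x y z → a :* (t :* x) :+ b :* (t :* y) :+ c :* (t :* z)
                             := t :* (a :* x :+ b :* y :+ c :* z))
    refl (fromℤ c₁) (fromℤ c₂) (fromℤ c₃) t p₁ p₂ p₃

dotQ-0Q : ∀ c → dotQ c 0Q ≡ 0ℚ
dotQ-0Q (c₁ , c₂ , c₃) =
  solve 3 (λ a b c → a :* con 0ℚ :+ b :* con 0ℚ :+ c :* con 0ℚ := con 0ℚ)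
    refl (fromℤ c₁) (fromℤ c₂) (fromℤ c₃)

dotQ-toQ : ∀ c u → dotQ c (toQ u) ≡ fromℤ (c · u)
dotQ-toQ (c₁ , c₂ , c₃) (x , y , z) = sym (begin
  fromℤ (c₁ ℤ.* x ℤ.+ c₂ ℤ.* y ℤ.+ c₃ ℤ.* z)
    ≡⟨ fromℤ-homo-+ (c₁ ℤ.* x ℤ.+ c₂ ℤ.* y) (c₃ ℤ.* z) ⟩
  fromℤ (c₁ ℤ.* x ℤ.+ c₂ ℤ.* y) ℚ.+ fromℤ (c₃ ℤ.* z)
    ≡⟨ cong₂ ℚ._+_ (fromℤ-homo-+ (c₁ ℤ.* x) (c₂ ℤ.* y)) (fromℤ-homo-* c₃ z) ⟩
  fromℤ (c₁ ℤ.* x) ℚ.+ fromℤ (c₂ ℤ.* y) ℚ.+ fromℤ c₃ ℚ.* fromℤ z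
    ≡⟨ cong₂ (λ s t → s ℚ.+ t ℚ.+ fromℤ c₃ ℚ.* fromℤ z) (fromℤ-homo-* c₁ x) (fromℤ-homo-* c₂ y) ⟩
  dotQ (c₁ , c₂ , c₃) (toQ (x , y , z)) ∎)

dotQ-combination : ∀ {n} c (w : Fin n → ℚ) (vs : Vec PtZ n) →
  dotQ c (sumQ (λ i → scaleQ (w i) (toQ (lookup vs i)))) ≡ sumℚ (λ i → w i ℚ.* fromℤ (c · lookup vs i))
dotQ-combination c w [] = dotQ-0Q c
dotQ-combination c w (v ∷ vs) = begin
  dotQ c (scaleQ (w zero) (toQ v) +Q rest)
    ≡⟨ dotQ-+Q c (scaleQ (w zero) (toQ v)) rest ⟩
  dotQ c (scaleQ (w zero) (toQ v)) ℚ.+ dotQ c rest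
    ≡⟨ cong₂ ℚ._+_ (trans (dotQ-scaleQ c (w zero) (toQ v)) (cong (w zero ℚ.*_) (dotQ-toQ c v)))
                   (dotQ-combination c (w ∘ suc) vs) ⟩
  sumℚ (λ i → w i ℚ.* fromℤ (c · lookup (v ∷ vs) i)) ∎
  where
  rest = sumQ (λ i → scaleQ (w (suc i)) (toQ (lookup vs i)))

affine-combination : ∀ {n} {vs : Vec PtZ n} {u} (p : LatticePt vs u) (h : Affine) →
  fromℤ (h ⟨ u ⟩) ≡ sumℚ (λ i → proj₁ p i ℚ.* fromℤ (h ⟨ lookup vs i ⟩))
affine-combination {vs = vs} {u} (w , _ , Σw≡1 , Σwv≡u) (c , d) = begin
  fromℤ (c · u ℤ.+ d)
    ≡⟨ fromℤ-homo-+ (c · u) d ⟩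
  fromℤ (c · u) ℚ.+ fromℤ d
    ≡⟨ cong₂ ℚ._+_ (sym (dotQ-toQ c u)) (sym (ℚₚ.*-identityˡ (fromℤ d))) ⟩
  dotQ c (toQ u) ℚ.+ 1ℚ ℚ.* fromℤ d
    ≡⟨ cong₂ (λ x t → dotQ c x ℚ.+ t ℚ.* fromℤ d) (sym Σwv≡u) (sym Σw≡1) ⟩
  dotQ c (sumQ (λ i → scaleQ (w i) (toQ (lookup vs i)))) ℚ.+ sumℚ w ℚ.* fromℤ d
    ≡⟨ cong (ℚ._+ sumℚ w ℚ.* fromℤ d) (dotQ-combination c w vs) ⟩
  sumℚ (λ i → w i ℚ.* fromℤ (c · lookup vs i)) ℚ.+ sumℚ w ℚ.* fromℤ d
    ≡⟨ sumℚ-*-distrib-+ w (λ i → fromℤ (c · lookup vs i)) (fromℤ d) ⟩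
  sumℚ (λ i → w i ℚ.* (fromℤ (c · lookup vs i) ℚ.+ fromℤ d))
    ≡⟨ sumℚ-cong (λ i → cong (w i ℚ.*_) (sym (fromℤ-homo-+ (c · lookup vs i) d))) ⟩
  sumℚ (λ i → w i ℚ.* fromℤ (c · lookup vs i ℤ.+ d)) ∎

scaleQ-0-+Q : ∀ p q → scaleQ 0ℚ p +Q q ≡ q
scaleQ-0-+Q (x , y , z) (a , b , c) = ≡-triple (zero-+ x a) (zero-+ y b) (zero-+ z c)
  where
  zero-+ : ∀ x a → 0ℚ ℚ.* x ℚ.+ a ≡ a
  zero-+ x a = trans (cong (ℚ._+ a) (ℚₚ.*-zeroˡ x)) (ℚₚ.+-identityˡ a)

scaleQ-1-+Q-0Q : ∀ p → scaleQ 1ℚ p +Q 0Q ≡ p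
scaleQ-1-+Q-0Q (x , y , z) = ≡-triple (one-+-0 x) (one-+-0 y) (one-+-0 z)
  where
  one-+-0 : ∀ x → 1ℚ ℚ.* x ℚ.+ 0ℚ ≡ x
  one-+-0 x = trans (ℚₚ.+-identityʳ (1ℚ ℚ.* x)) (ℚₚ.*-identityˡ x)

sumQ-scaleQ-0 : ∀ {n} (vs : Vec PtZ n) → sumQ (λ i → scaleQ 0ℚ (toQ (lookup vs i))) ≡ 0Q
sumQ-scaleQ-0 [] = refl
sumQ-scaleQ-0 (v ∷ vs) = trans (cong (scaleQ 0ℚ (toQ v) +Q_) (sumQ-scaleQ-0 vs)) (scaleQ-0-+Q (toQ v) 0Q)

vertex-mem : ∀ {n} (vs : Vec PtZ n) j → InConv vs (toQ (lookup vs j))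
vertex-mem {suc n} (v ∷ vs) zero = w , w≥0 , Σw≡1 , Σwv≡v
  where
  w : Fin (suc n) → ℚ
  w zero = 1ℚ
  w (suc i) = 0ℚ
  w≥0 : ∀ i → 0ℚ ℚ.≤ w i
  w≥0 zero = ℚₚ.nonNegative⁻¹ 1ℚ
  w≥0 (suc i) = ℚₚ.≤-refl
  Σw≡1 : sumℚ w ≡ 1ℚ
  Σw≡1 = trans (cong (1ℚ ℚ.+_) (sumℚ-zero {n} (λ _ → refl))) (ℚₚ.+-identityʳ 1ℚ)
  Σwv≡v : sumQ (λ i → scaleQ (w i) (toQ (lookup (v ∷ vs) i))) ≡ toQ v
  Σwv≡v = trans (cong (scaleQ 1ℚ (toQ v) +Q_) (sumQ-scaleQ-0 vs)) (scaleQ-1-+Q-0Q (toQ v))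
vertex-mem (v ∷ vs) (suc j) with vertex-mem vs j
... | w , w≥0 , Σw≡1 , Σwv≡vⱼ = w′ , w′≥0 , trans (ℚₚ.+-identityˡ (sumℚ w)) Σw≡1 ,
                                trans (scaleQ-0-+Q (toQ v) _) Σwv≡vⱼ
  where
  w′ : Fin _ → ℚ
  w′ zero = 0ℚ
  w′ (suc i) = w i
  w′≥0 : ∀ i → 0ℚ ℚ.≤ w′ i
  w′≥0 zero = ℚₚ.≤-refl
  w′≥0 (suc i) = w≥0 i

i<j⇒0<j-i : ∀ {i j} → i < j → + 0 < j ℤ.- i
i<j⇒0<j-i {i} {j} i<j = subst (_< j ℤ.- i) (ℤₚ.+-inverseʳ i) (ℤₚ.+-monoˡ-< (ℤ.- i) i<j)

interpolation : ∀ {a b j} → a < b → a ≤ j → j ≤ b →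
  Σ ℚ λ s → Σ ℚ λ t → 0ℚ ℚ.≤ s × 0ℚ ℚ.≤ t × s ℚ.+ t ≡ 1ℚ × s ℚ.* fromℤ a ℚ.+ t ℚ.* fromℤ b ≡ fromℤ j
interpolation {a} {b} {j} a<b a≤j j≤b =
  fromℤ (b ℤ.- j) ℚ.* r , fromℤ (j ℤ.- a) ℚ.* r ,
  *-nonneg (fromℤ-mono-≤ (ℤₚ.i≤j⇒0≤j-i j≤b)) (1/fromℤ-nonneg 0<b-a) ,
  *-nonneg (fromℤ-mono-≤ (ℤₚ.i≤j⇒0≤j-i a≤j)) (1/fromℤ-nonneg 0<b-a) ,
  s+t≡1 , sa+tb≡j
  where
  0<b-a : + 0 < b ℤ.- a
  0<b-a = i<j⇒0<j-i a<b
  r : ℚ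
  r = 1/fromℤ 0<b-a
  weights-sum : ∀ a b j → b ℤ.- j ℤ.+ (j ℤ.- a) ≡ + 1 ℤ.* (b ℤ.- a)
  weights-sum = solve-∀
  weights-combine : ∀ a b j → (b ℤ.- j) ℤ.* a ℤ.+ (j ℤ.- a) ℤ.* b ≡ j ℤ.* (b ℤ.- a)
  weights-combine = solve-∀
  s+t≡1 : fromℤ (b ℤ.- j) ℚ.* r ℚ.+ fromℤ (j ℤ.- a) ℚ.* r ≡ 1ℚ
  s+t≡1 = begin
    fromℤ (b ℤ.- j) ℚ.* r ℚ.+ fromℤ (j ℤ.- a) ℚ.* r ≡⟨ ℚₚ.*-distribʳ-+ r (fromℤ (b ℤ.- j)) (fromℤ (j ℤ.- a)) ⟨
    (fromℤ (b ℤ.- j) ℚ.+ fromℤ (j ℤ.- a)) ℚ.* r     ≡⟨ cong (ℚ._* r) (fromℤ-homo-+ (b ℤ.- j) (j ℤ.- a)) ⟨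
    fromℤ (b ℤ.- j ℤ.+ (j ℤ.- a)) ℚ.* r             ≡⟨ cong (λ t → fromℤ t ℚ.* r) (weights-sum a b j) ⟩
    fromℤ (+ 1 ℤ.* (b ℤ.- a)) ℚ.* r                 ≡⟨ fromℤ-*-1/fromℤ 0<b-a (+ 1) ⟩
    1ℚ                                              ∎
  sa+tb≡j : fromℤ (b ℤ.- j) ℚ.* r ℚ.* fromℤ a ℚ.+ fromℤ (j ℤ.- a) ℚ.* r ℚ.* fromℤ b ≡ fromℤ j
  sa+tb≡j = begin
    fromℤ (b ℤ.- j) ℚ.* r ℚ.* fromℤ a ℚ.+ fromℤ (j ℤ.- a) ℚ.* r ℚ.* fromℤ b
      ≡⟨ solve 5 (λ p q r x y → p :* r :* x :+ q :* r :* y := (p :* x :+ q :* y) :* r)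
           refl (fromℤ (b ℤ.- j)) (fromℤ (j ℤ.- a)) r (fromℤ a) (fromℤ b) ⟩
    (fromℤ (b ℤ.- j) ℚ.* fromℤ a ℚ.+ fromℤ (j ℤ.- a) ℚ.* fromℤ b) ℚ.* r
      ≡⟨ cong (ℚ._* r) (cong₂ ℚ._+_ (fromℤ-homo-* (b ℤ.- j) a) (fromℤ-homo-* (j ℤ.- a) b)) ⟨
    (fromℤ ((b ℤ.- j) ℤ.* a) ℚ.+ fromℤ ((j ℤ.- a) ℤ.* b)) ℚ.* r
      ≡⟨ cong (ℚ._* r) (fromℤ-homo-+ ((b ℤ.- j) ℤ.* a) ((j ℤ.- a) ℤ.* b)) ⟨
    fromℤ ((b ℤ.- j) ℤ.* a ℤ.+ (j ℤ.- a) ℤ.* b) ℚ.* r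
      ≡⟨ cong (λ t → fromℤ t ℚ.* r) (weights-combine a b j) ⟩
    fromℤ (j ℤ.* (b ℤ.- a)) ℚ.* r
      ≡⟨ fromℤ-*-1/fromℤ 0<b-a j ⟩
    fromℤ j ∎

axis-combination : ∀ {m} {a b j : ℤ} (rest : Vec PtZ m) s t → 0ℚ ℚ.≤ s → 0ℚ ℚ.≤ t → s ℚ.+ t ≡ 1ℚ →
  s ℚ.* fromℤ a ℚ.+ t ℚ.* fromℤ b ≡ fromℤ j →
  InConv (axis a ∷ axis b ∷ rest) (toQ (axis j))
axis-combination {m} {a} {b} {j} rest s t s≥0 t≥0 s+t≡1 sa+tb≡j = w , w≥0 , Σw≡1 , Σwv≡j
  where
  w : Fin (2 ℕ.+ m) → ℚ
  w zero = s
  w (suc zero) = t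
  w (suc (suc i)) = 0ℚ
  w≥0 : ∀ i → 0ℚ ℚ.≤ w i
  w≥0 zero = s≥0
  w≥0 (suc zero) = t≥0
  w≥0 (suc (suc i)) = ℚₚ.≤-refl
  Σw≡1 : sumℚ w ≡ 1ℚ
  Σw≡1 = trans (cong (λ r → s ℚ.+ (t ℚ.+ r)) (sumℚ-zero {m} (λ _ → refl)))
               (trans (cong (s ℚ.+_) (ℚₚ.+-identityʳ t)) s+t≡1)
  off-axis : ∀ p q → p ℚ.* 0ℚ ℚ.+ (q ℚ.* 0ℚ ℚ.+ 0ℚ) ≡ 0ℚ
  off-axis = solve 2 (λ p q → p :* con 0ℚ :+ (q :* con 0ℚ :+ con 0ℚ) := con 0ℚ) refl
  Σwv≡j : sumQ (λ i → scaleQ (w i) (toQ (lookup (axis a ∷ axis b ∷ rest) i)))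
          ≡ toQ (axis j)
  Σwv≡j rewrite sumQ-scaleQ-0 rest =
    ≡-triple (off-axis s t) (off-axis s t)
             (trans (cong (s ℚ.* fromℤ a ℚ.+_) (ℚₚ.+-identityʳ (t ℚ.* fromℤ b))) sa+tb≡j)

axis-point-mem : ∀ {m} {a b j : ℤ} (rest : Vec PtZ m) → a < b → a ≤ j → j ≤ b →
  InConv (axis a ∷ axis b ∷ rest) (toQ (axis j))
axis-point-mem {a = a} {b} {j} rest a<b a≤j j≤b =
  let s , t , s≥0 , t≥0 , s+t≡1 , sa+tb≡j = interpolation a<b a≤j j≤b
  in axis-combination {a = a} {b} {j} rest s t s≥0 t≥0 s+t≡1 sa+tb≡j

module Barycentric {n} (vs : Vec PtZ n) (u : PtZ) (p : LatticePt vs u) where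

  weight : Fin n → ℚ
  weight = proj₁ p

  weight-nonneg : ∀ i → 0ℚ ℚ.≤ weight i
  weight-nonneg = proj₁ (proj₂ p)

  weight-pos-or-zero : ∀ i → 0ℚ ℚ.< weight i ⊎ weight i ≡ 0ℚ
  weight-pos-or-zero i with 0ℚ ℚₚ.<? weight i
  ... | yes wᵢ>0 = inj₁ wᵢ>0
  ... | no wᵢ≯0 = inj₂ (ℚₚ.≤-antisym (ℚₚ.≮⇒≥ wᵢ≯0) (weight-nonneg i))

  module _ (h : Affine) where

    private
      h-at-u : fromℤ (h ⟨ u ⟩) ≡ sumℚ (λ i → weight i ℚ.* fromℤ (h ⟨ lookup vs i ⟩))
      h-at-u = affine-combination {vs = vs} {u} p h

    affine-nonneg : (∀ i → + 0 ≤ h ⟨ lookup vs i ⟩) → + 0 ≤ h ⟨ u ⟩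
    affine-nonneg h≥0 = fromℤ-cancel-≤ (subst (0ℚ ℚ.≤_) (sym h-at-u)
      (sumℚ-nonneg (λ i → *-nonneg (weight-nonneg i) (fromℤ-mono-≤ (h≥0 i)))))

    affine-pos : (∀ i → + 0 ≤ h ⟨ lookup vs i ⟩) → ∀ j → 0ℚ ℚ.< weight j → + 0 < h ⟨ lookup vs j ⟩ →
                 + 0 < h ⟨ u ⟩
    affine-pos h≥0 j wⱼ>0 hⱼ>0 = fromℤ-cancel-< (subst (0ℚ ℚ.<_) (sym h-at-u)
      (sumℚ-pos (λ i → *-nonneg (weight-nonneg i) (fromℤ-mono-≤ (h≥0 i))) j
                (*-pos wⱼ>0 (fromℤ-mono-< hⱼ>0))))

    affine-zero : (∀ i → weight i ≡ 0ℚ ⊎ h ⟨ lookup vs i ⟩ ≡ + 0) → h ⟨ u ⟩ ≡ + 0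
    affine-zero vanish = fromℤ-injective (trans h-at-u (sumℚ-zero term≡0))
      where
      term≡0 : ∀ i → weight i ℚ.* fromℤ (h ⟨ lookup vs i ⟩) ≡ 0ℚ
      term≡0 i with vanish i
      ... | inj₁ wᵢ≡0 = trans (cong (ℚ._* fromℤ (h ⟨ lookup vs i ⟩)) wᵢ≡0) (ℚₚ.*-zeroˡ (fromℤ (h ⟨ lookup vs i ⟩)))
      ... | inj₂ hᵢ≡0 = trans (cong (λ t → weight i ℚ.* fromℤ t) hᵢ≡0) (ℚₚ.*-zeroʳ (weight i))

    weight-zero-off-face : (∀ i → + 0 ≤ h ⟨ lookup vs i ⟩) → h ⟨ u ⟩ ≡ + 0 →
                           ∀ j → + 0 < h ⟨ lookup vs j ⟩ → weight j ≡ 0ℚ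
    weight-zero-off-face h≥0 h≡0 j hⱼ>0 with weight-pos-or-zero j
    ... | inj₁ wⱼ>0 = ⊥-elim (ℤₚ.<-irrefl (sym h≡0) (affine-pos h≥0 j wⱼ>0 hⱼ>0))
    ... | inj₂ wⱼ≡0 = wⱼ≡0

  vanish-on-face : ∀ h → (∀ i → + 0 ≤ h ⟨ lookup vs i ⟩) → h ⟨ u ⟩ ≡ + 0 →
                   ∀ φ → (∀ i → + 0 < h ⟨ lookup vs i ⟩ ⊎ φ ⟨ lookup vs i ⟩ ≡ + 0) → φ ⟨ u ⟩ ≡ + 0
  vanish-on-face h h≥0 h≡0 φ φ-on-face =
    affine-zero φ (λ i → Sum.map₁ (weight-zero-off-face h h≥0 h≡0 i) (φ-on-face i))

module AxisBarycentric {m} (vs : Vec PtZ (2 ℕ.+ m)) (u : PtZ) (p : LatticePt vs u) where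

  open Barycentric vs u p public

  AxisWeighted : Set
  AxisWeighted = 0ℚ ℚ.< weight zero ⊎ 0ℚ ℚ.< weight (suc zero)

  axis-weighted-or-not : AxisWeighted ⊎ (weight zero ≡ 0ℚ × weight (suc zero) ≡ 0ℚ)
  axis-weighted-or-not with weight-pos-or-zero zero | weight-pos-or-zero (suc zero)
  ... | inj₁ w₀>0 | _ = inj₁ (inj₁ w₀>0)
  ... | inj₂ w₀≡0 | inj₁ w₁>0 = inj₁ (inj₂ w₁>0)
  ... | inj₂ w₀≡0 | inj₂ w₁≡0 = inj₂ (w₀≡0 , w₁≡0)

  affine-pos-axis : AxisWeighted → ∀ h → (∀ i → + 0 ≤ h ⟨ lookup vs i ⟩) →
    + 0 < h ⟨ lookup vs zero ⟩ → + 0 < h ⟨ lookup vs (suc zero) ⟩ → + 0 < h ⟨ u ⟩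
  affine-pos-axis (inj₁ w₀>0) h h≥0 h₀>0 h₁>0 = affine-pos h h≥0 zero w₀>0 h₀>0
  affine-pos-axis (inj₂ w₁>0) h h≥0 h₀>0 h₁>0 = affine-pos h h≥0 (suc zero) w₁>0 h₁>0

  affine-zero-off-axis : weight zero ≡ 0ℚ × weight (suc zero) ≡ 0ℚ → ∀ h →
    (∀ i → h ⟨ lookup vs (suc (suc i)) ⟩ ≡ + 0) → h ⟨ u ⟩ ≡ + 0
  affine-zero-off-axis (w₀≡0 , w₁≡0) h h≡0 = affine-zero h λ
    { zero → inj₁ w₀≡0
    ; (suc zero) → inj₁ w₁≡0
    ; (suc (suc i)) → inj₂ (h≡0 i) }

-- The implicit proof is found by normalisation, so this applies only when every value
-- h ⟨ v ⟩ at a vertex reduces to a numeral.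
nonneg-by-evaluation : ∀ {n} (vs : Vec PtZ n) h →
  {True (Finₚ.all? λ i → + 0 ℤₚ.≤? h ⟨ lookup vs i ⟩)} → ∀ i → + 0 ≤ h ⟨ lookup vs i ⟩
nonneg-by-evaluation vs h {all-nonneg} = toWitness all-nonneg


-- Width

spread : ∀ {n} → Vec PtZ n → PtZ → Fin n → Fin n → ℤ
spread vs c i j = c · lookup vs i ℤ.- c · lookup vs j

Flat : ∀ {n} → Vec PtZ n → PtZ → Set
Flat vs c = ∀ i j → ∣ spread vs c i j ∣ ℕ.≤ 1

1<∣i-j∣ : ∀ i j → 1 ℕ.< ∣ i ℤ.- j ∣ → + 1 < i ℤ.- j ⊎ + 1 < j ℤ.- i
1<∣i-j∣ i j 1<∣i-j∣ with i ℤ.- j in eq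
... | + n = inj₁ (+<+ 1<∣i-j∣)
... | -[1+ n ] = inj₂ (subst (+ 1 <_) (sym j-i≡1+n) (+<+ 1<∣i-j∣))
  where
  [j-i]≡-[i-j] : ∀ i j → j ℤ.- i ≡ ℤ.- (i ℤ.- j)
  [j-i]≡-[i-j] = solve-∀
  j-i≡1+n : j ℤ.- i ≡ + suc n
  j-i≡1+n = trans ([j-i]≡-[i-j] i j) (cong ℤ.-_ eq)

spread-witness : ∀ {n} (vs : Vec PtZ n) c i j → + 1 < spread vs c i j →
  Σ PtQ λ x → Σ PtQ λ y → InConv vs x × InConv vs y × (1ℚ ℚ.< dotQ c x ℚ.- dotQ c y)
spread-witness vs c i j 1<spread =
  toQ (lookup vs i) , toQ (lookup vs j) , vertex-mem vs i , vertex-mem vs j ,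
  subst (1ℚ ℚ.<_) (sym dot-spread) (fromℤ-mono-< 1<spread)
  where
  dot-spread : dotQ c (toQ (lookup vs i)) ℚ.- dotQ c (toQ (lookup vs j)) ≡ fromℤ (spread vs c i j)
  dot-spread = trans (cong₂ ℚ._-_ (dotQ-toQ c (lookup vs i)) (dotQ-toQ c (lookup vs j)))
                     (sym (fromℤ-homo-- (c · lookup vs i) (c · lookup vs j)))

only-zero-flat⇒WidthGT1 : ∀ {n} (vs : Vec PtZ n) → (∀ c → Flat vs c → c ≡ 0Z) → WidthGT1 vs
only-zero-flat⇒WidthGT1 {n} vs flat⇒0 c c≢0
  with Finₚ.all? (λ i → Finₚ.all? (λ j → ∣ spread vs c i j ∣ ℕ.≤? 1))
... | yes flat = ⊥-elim (c≢0 (flat⇒0 c flat))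
... | no ¬flat
  with Finₚ.¬∀⟶∃¬ n _ (λ i → Finₚ.all? (λ j → ∣ spread vs c i j ∣ ℕ.≤? 1)) ¬flat
... | i , ¬flatᵢ
  with Finₚ.¬∀⟶∃¬ n _ (λ j → ∣ spread vs c i j ∣ ℕ.≤? 1) ¬flatᵢ
... | j , ¬flatᵢⱼ
  with 1<∣i-j∣ (c · lookup vs i) (c · lookup vs j) (ℕₚ.≰⇒> ¬flatᵢⱼ)
... | inj₁ 1<spreadᵢⱼ = spread-witness vs c i j 1<spreadᵢⱼ
... | inj₂ 1<spreadⱼᵢ = spread-witness vs c j i 1<spreadⱼᵢ

small-multiple≡0 : ∀ m n {x} → m ℤ.* + n ≡ x → ∣ x ∣ ℕ.< n → m ≡ + 0
small-multiple≡0 m n mn≡x ∣x∣<n =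
  ℤₚ.∣i∣≡0⇒i≡0 (ℕₚ.n<1⇒n≡0 (ℕₚ.*-cancelʳ-< n ∣ m ∣ 1 ∣m∣n<1n))
  where
  ∣m∣n<1n : ∣ m ∣ ℕ.* n ℕ.< 1 ℕ.* n
  ∣m∣n<1n = subst₂ ℕ._<_ (trans (cong ∣_∣ (sym mn≡x)) (ℤₚ.abs-* m (+ n))) (sym (ℕₚ.*-identityˡ n)) ∣x∣<n

pair-flat : ∀ x y → x ℤ.+ y ≡ + 0 → ∣ x ℤ.- y ∣ ℕ.≤ 1 → x ≡ + 0
pair-flat x y x+y≡0 ∣x-y∣≤1 = small-multiple≡0 x 2 2x≡x-y (s≤s ∣x-y∣≤1)
  where
  split : ∀ x y → x ℤ.* + 2 ≡ (x ℤ.- y) ℤ.+ (x ℤ.+ y)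
  split = solve-∀
  2x≡x-y : x ℤ.* + 2 ≡ x ℤ.- y
  2x≡x-y = begin
    x ℤ.* + 2                   ≡⟨ split x y ⟩
    (x ℤ.- y) ℤ.+ (x ℤ.+ y)     ≡⟨ cong (λ t → (x ℤ.- y) ℤ.+ t) x+y≡0 ⟩
    (x ℤ.- y) ℤ.+ + 0           ≡⟨ ℤₚ.+-identityʳ (x ℤ.- y) ⟩
    x ℤ.- y                     ∎

triple-flat : ∀ x y z → x ℤ.+ y ℤ.+ z ≡ + 0 → ∣ x ℤ.- y ∣ ℕ.≤ 1 → ∣ x ℤ.- z ∣ ℕ.≤ 1 → x ≡ + 0
triple-flat x y z x+y+z≡0 ∣x-y∣≤1 ∣x-z∣≤1 = small-multiple≡0 x 3 3x≡[x-y]+[x-z]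
  (ℕₚ.≤-<-trans (ℤₚ.∣i+j∣≤∣i∣+∣j∣ (x ℤ.- y) (x ℤ.- z)) (s≤s (ℕₚ.+-mono-≤ ∣x-y∣≤1 ∣x-z∣≤1)))
  where
  split : ∀ x y z → x ℤ.* + 3 ≡ (x ℤ.- y) ℤ.+ (x ℤ.- z) ℤ.+ (x ℤ.+ y ℤ.+ z)
  split = solve-∀
  3x≡[x-y]+[x-z] : x ℤ.* + 3 ≡ (x ℤ.- y) ℤ.+ (x ℤ.- z)
  3x≡[x-y]+[x-z] = begin
    x ℤ.* + 3                                        ≡⟨ split x y z ⟩
    (x ℤ.- y) ℤ.+ (x ℤ.- z) ℤ.+ (x ℤ.+ y ℤ.+ z)      ≡⟨ cong (λ t → (x ℤ.- y) ℤ.+ (x ℤ.- z) ℤ.+ t) x+y+z≡0 ⟩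
    (x ℤ.- y) ℤ.+ (x ℤ.- z) ℤ.+ + 0                  ≡⟨ ℤₚ.+-identityʳ ((x ℤ.- y) ℤ.+ (x ℤ.- z)) ⟩
    (x ℤ.- y) ℤ.+ (x ℤ.- z)                          ∎

∣i∣≤∣i*j∣ : ∀ i {j} → + 0 < j → ∣ i ∣ ℕ.≤ ∣ i ℤ.* j ∣
∣i∣≤∣i*j∣ i {+ zero} (+<+ ())
∣i∣≤∣i*j∣ i {+ suc n} _ = subst (∣ i ∣ ℕ.≤_) (sym (ℤₚ.abs-* i (+ suc n))) (ℕₚ.m≤m*n ∣ i ∣ (suc n))

axis-spread : ∀ c a b → c · axis b ℤ.- c · axis a ≡ proj₂ (proj₂ c) ℤ.* (b ℤ.- a)
axis-spread c a b = trans (cong₂ ℤ._-_ (·-axis c b) (·-axis c a)) (factor (proj₂ (proj₂ c)) b a)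
  where
  factor : ∀ k b a → k ℤ.* b ℤ.- k ℤ.* a ≡ k ℤ.* (b ℤ.- a)
  factor = solve-∀

axis-flat : ∀ c a b → ∣ c · axis b ℤ.- c · axis a ∣ ℕ.≤ 1 →
            ∣ proj₂ (proj₂ c) ℤ.* (b ℤ.- a) ∣ ℕ.≤ 1
axis-flat c a b = subst (λ t → ∣ t ∣ ℕ.≤ 1) (axis-spread c a b)


-- Index

residue-injective : ∀ {m} (i j : Fin m) → + m ∣ + toℕ i ℤ.- + toℕ j → i ≡ j
residue-injective {m} i j (divides q i-j≡qm) =
  Finₚ.toℕ-injective (ℤₚ.+-injective (ℤₚ.i-j≡0⇒i≡j _ _ (trans i-j≡qm (cong (ℤ._* + m) q≡0))))
  where
  ∣i-j∣<m : ∣ + toℕ i ℤ.- + toℕ j ∣ ℕ.< m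
  ∣i-j∣<m = subst (ℕ._< m) (cong ∣_∣ (sym (ℤₚ.m-n≡m⊖n (toℕ i) (toℕ j))))
              (ℕₚ.≤-<-trans (ℤₚ.∣m⊝n∣≤m⊔n (toℕ i) (toℕ j)) (ℕₚ.⊔-lub (Finₚ.toℕ<n i) (Finₚ.toℕ<n j)))
  q≡0 : q ≡ + 0
  q≡0 = small-multiple≡0 q m (sym i-j≡qm) ∣i-j∣<m

infixr 8 _⋆_
_⋆_ : ℤ → PtZ → PtZ
k ⋆ (x , y , z) = k ℤ.* x , k ℤ.* y , k ℤ.* z

residue-decomposition : ∀ m .{{_ : ℕ.NonZero m}} s x y z → ∃ λ (i : Fin m) → ∃ λ q →
  (x , y , z) -Z (+ toℕ i , + 0 , + 0)
    ≡ q ⋆ (+ m , + 0 , + 0) +Z y ⋆ (ℤ.- s , + 1 , + 0) +Z z ⋆ (+ 0 , + 0 , + 1)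
residue-decomposition m s x y z = i , q , ≡-triple (sym first) (sym second) (sym third)
  where
  n = x ℤ.+ s ℤ.* y
  q = n ℤ./ℕ m
  i : Fin m
  i = fromℕ< (n%ℕd<d n m)
  n≡i+qm : n ≡ + toℕ i ℤ.+ q ℤ.* + m
  n≡i+qm = trans (a≡a%ℕn+[a/ℕn]*n n m) (cong (λ r → + r ℤ.+ q ℤ.* + m) (sym (Finₚ.toℕ-fromℕ< (n%ℕd<d n m))))
  regroup : ∀ q m y s z r → q ℤ.* m ℤ.+ y ℤ.* ℤ.- s ℤ.+ z ℤ.* + 0 ≡ (r ℤ.+ q ℤ.* m) ℤ.- s ℤ.* y ℤ.- r
  regroup = solve-∀
  cancel : ∀ x s y r → (x ℤ.+ s ℤ.* y) ℤ.- s ℤ.* y ℤ.- r ≡ x ℤ.- r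
  cancel = solve-∀
  first : q ℤ.* + m ℤ.+ y ℤ.* ℤ.- s ℤ.+ z ℤ.* + 0 ≡ x ℤ.- + toℕ i
  first = begin
    q ℤ.* + m ℤ.+ y ℤ.* ℤ.- s ℤ.+ z ℤ.* + 0          ≡⟨ regroup q (+ m) y s z (+ toℕ i) ⟩
    (+ toℕ i ℤ.+ q ℤ.* + m) ℤ.- s ℤ.* y ℤ.- + toℕ i ≡⟨ cong (λ t → t ℤ.- s ℤ.* y ℤ.- + toℕ i) n≡i+qm ⟨
    (x ℤ.+ s ℤ.* y) ℤ.- s ℤ.* y ℤ.- + toℕ i          ≡⟨ cancel x s y (+ toℕ i) ⟩
    x ℤ.- + toℕ i                                    ∎
  second : q ℤ.* + 0 ℤ.+ y ℤ.* + 1 ℤ.+ z ℤ.* + 0 ≡ y ℤ.- + 0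
  second = lemma q y z
    where
    lemma : ∀ q y z → q ℤ.* + 0 ℤ.+ y ℤ.* + 1 ℤ.+ z ℤ.* + 0 ≡ y ℤ.- + 0
    lemma = solve-∀
  third : q ℤ.* + 0 ℤ.+ y ℤ.* + 0 ℤ.+ z ℤ.* + 1 ≡ z ℤ.- + 0
  third = lemma q y z
    where
    lemma : ∀ q y z → q ℤ.* + 0 ℤ.+ y ℤ.* + 0 ℤ.+ z ℤ.* + 1 ≡ z ℤ.- + 0
    lemma = solve-∀

module _ {S : PtZ → Set} where

  DiffLattice-divisible : ∀ g m → (∀ u → S u → m ∣ g · u) → ∀ {u} → DiffLattice S u → m ∣ g · u
  DiffLattice-divisible g m m∣ (diff {u} {v} Su Sv) =
    subst (m ∣_) (sym (·--Z g u v)) (∣m∣n⇒∣m-n (m∣ u Su) (m∣ v Sv))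
  DiffLattice-divisible g m m∣ zer = subst (m ∣_) (sym (·-0Z g)) (divides (+ 0) refl)
  DiffLattice-divisible g m m∣ (add {u} {v} du dv) =
    subst (m ∣_) (sym (·-+Z g u v))
      (∣m∣n⇒∣m+n (DiffLattice-divisible g m m∣ du) (DiffLattice-divisible g m m∣ dv))
  DiffLattice-divisible g m m∣ (neg {u} du) =
    subst (m ∣_) (sym (·-negZ g u)) (∣m⇒∣-m (DiffLattice-divisible g m m∣ du))

  DiffLattice-+⋆ : ∀ {u} → DiffLattice S u → ∀ n → DiffLattice S ((+ n) ⋆ u)
  DiffLattice-+⋆ du zero = zer
  DiffLattice-+⋆ {x , y , z} du (suc n) =
    subst (DiffLattice S) (≡-triple (sym (suc-* (+ n) x)) (sym (suc-* (+ n) y)) (sym (suc-* (+ n) z)))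
      (add (DiffLattice-+⋆ du n) du)
    where
    suc-* : ∀ m x → (+ 1 ℤ.+ m) ℤ.* x ≡ m ℤ.* x ℤ.+ x
    suc-* = solve-∀

  DiffLattice-⋆ : ∀ {u} → DiffLattice S u → ∀ k → DiffLattice S (k ⋆ u)
  DiffLattice-⋆ du (+ n) = DiffLattice-+⋆ du n
  DiffLattice-⋆ {x , y , z} du -[1+ n ] =
    subst (DiffLattice S)
      (≡-triple (ℤₚ.neg-distribˡ-* (+ suc n) x) (ℤₚ.neg-distribˡ-* (+ suc n) y) (ℤₚ.neg-distribˡ-* (+ suc n) z))
      (neg (DiffLattice-+⋆ du (suc n)))

  index-from-functional : ∀ m .{{_ : ℕ.NonZero m}} (s : ℤ) →
    (∀ u → S u → + m ∣ (+ 1 , s , + 0) · u) →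
    DiffLattice S (+ m , + 0 , + 0) → DiffLattice S (ℤ.- s , + 1 , + 0) → DiffLattice S (+ 0 , + 0 , + 1) →
    HasIndex S m
  index-from-functional m s m∣g e₁ e₂ e₃ = rep , rep-injective , rep-surjective
    where
    g : PtZ
    g = + 1 , s , + 0
    rep : Fin m → PtZ
    rep i = + toℕ i , + 0 , + 0
    g·-first : ∀ s x → + 1 ℤ.* x ℤ.+ s ℤ.* + 0 ℤ.+ + 0 ℤ.* + 0 ≡ x
    g·-first = solve-∀
    rep-injective : ∀ i j → DiffLattice S (rep i -Z rep j) → i ≡ j
    rep-injective i j d = residue-injective i j
      (subst (+ m ∣_) (g·-first s (+ toℕ i ℤ.- + toℕ j)) (DiffLattice-divisible g (+ m) m∣g d))
    rep-surjective : ∀ u → ∃ λ i → DiffLattice S (u -Z rep i)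
    rep-surjective (x , y , z) with residue-decomposition m s x y z
    ... | i , q , u-rep≡ = i , subst (DiffLattice S) (sym u-rep≡)
                                 (add (add (DiffLattice-⋆ e₁ q) (DiffLattice-⋆ e₂ y)) (DiffLattice-⋆ e₃ z))

divisible-by-plane : ∀ g₁ g₂ t m u → ((g₁ , g₂ , t ℤ.* m) , + 0) ⟨ u ⟩ ≡ + 0 → m ∣ (g₁ , g₂ , + 0) · u
divisible-by-plane g₁ g₂ t m (x , y , z) plane≡0 = divides (ℤ.- (t ℤ.* z)) (begin
  g₁ ℤ.* x ℤ.+ g₂ ℤ.* y ℤ.+ + 0 ℤ.* z                          ≡⟨ split g₁ g₂ t m x y z ⟩
  ((g₁ , g₂ , t ℤ.* m) , + 0) ⟨ x , y , z ⟩ ℤ.+ ℤ.- (t ℤ.* z) ℤ.* m ≡⟨ cong (ℤ._+ ℤ.- (t ℤ.* z) ℤ.* m) plane≡0 ⟩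
  + 0 ℤ.+ ℤ.- (t ℤ.* z) ℤ.* m                                  ≡⟨ ℤₚ.+-identityˡ (ℤ.- (t ℤ.* z) ℤ.* m) ⟩
  ℤ.- (t ℤ.* z) ℤ.* m                                          ∎)
  where
  split : ∀ g₁ g₂ t m x y z → g₁ ℤ.* x ℤ.+ g₂ ℤ.* y ℤ.+ + 0 ℤ.* z
          ≡ (g₁ ℤ.* x ℤ.+ g₂ ℤ.* y ℤ.+ t ℤ.* m ℤ.* z ℤ.+ + 0) ℤ.+ ℤ.- (t ℤ.* z) ℤ.* m
  split = solve-∀


x+1 y+1 : Affine
x+1 = (+ 1 , + 0 , + 0) , + 1
y+1 = (+ 0 , + 1 , + 0) , + 1

x+1⟨_,_,_⟩ : ∀ x y z → x+1 ⟨ x , y , z ⟩ ≡ x ℤ.+ + 1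
x+1⟨ x , y , z ⟩ = lemma x y z
  where
  lemma : ∀ x y z → + 1 ℤ.* x ℤ.+ + 0 ℤ.* y ℤ.+ + 0 ℤ.* z ℤ.+ + 1 ≡ x ℤ.+ + 1
  lemma = solve-∀

y+1⟨_,_,_⟩ : ∀ x y z → y+1 ⟨ x , y , z ⟩ ≡ y ℤ.+ + 1
y+1⟨ x , y , z ⟩ = lemma x y z
  where
  lemma : ∀ x y z → + 0 ℤ.* x ℤ.+ + 1 ℤ.* y ℤ.+ + 0 ℤ.* z ℤ.+ + 1 ≡ y ℤ.+ + 1
  lemma = solve-∀

1-x 1-y : Affine
1-x = (-1ℤ , + 0 , + 0) , + 1
1-y = (+ 0 , -1ℤ , + 0) , + 1

1-x⟨_,_,_⟩ : ∀ x y z → 1-x ⟨ x , y , z ⟩ ≡ ℤ.- x ℤ.+ + 1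
1-x⟨ x , y , z ⟩ = lemma x y z
  where
  lemma : ∀ x y z → -1ℤ ℤ.* x ℤ.+ + 0 ℤ.* y ℤ.+ + 0 ℤ.* z ℤ.+ + 1 ≡ ℤ.- x ℤ.+ + 1
  lemma = solve-∀

1-y⟨_,_,_⟩ : ∀ x y z → 1-y ⟨ x , y , z ⟩ ≡ ℤ.- y ℤ.+ + 1
1-y⟨ x , y , z ⟩ = lemma x y z
  where
  lemma : ∀ x y z → + 0 ℤ.* x ℤ.+ -1ℤ ℤ.* y ℤ.+ + 0 ℤ.* z ℤ.+ + 1 ≡ ℤ.- y ℤ.+ + 1
  lemma = solve-∀

0<1 : + 0 < + 1
0<1 = +<+ (s≤s z≤n)

0<2 : + 0 < + 2
0<2 = +<+ (s≤s z≤n)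

0<t+1⇒0≤t : ∀ {t} → + 0 < t ℤ.+ + 1 → + 0 ≤ t
0<t+1⇒0≤t {+ n} _ = +≤+ z≤n
0<t+1⇒0≤t { -[1+ zero ]} (+<+ ())
0<t+1⇒0≤t { -[1+ suc n ]} ()

origin-of-cone : ∀ {x y} → + 0 ≤ x → + 0 ≤ y → + 0 ≤ ℤ.- (x ℤ.+ y) → x ≡ + 0 × y ≡ + 0
origin-of-cone {+ zero} {+ zero} _ _ _ = refl , refl
origin-of-cone {+ zero} {+ suc n} _ _ ()
origin-of-cone {+ suc m} {+ n} _ _ ()

unit-range : ∀ {t} → + 0 ≤ t ℤ.+ + 1 → + 0 ≤ ℤ.- t ℤ.+ + 1 → t ≡ -1ℤ ⊎ t ≡ + 0 ⊎ t ≡ + 1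
unit-range { + zero} _ _ = inj₂ (inj₁ refl)
unit-range { + suc zero} _ _ = inj₂ (inj₂ refl)
unit-range { + suc (suc n)} _ ()
unit-range { -[1+ zero ]} _ _ = inj₁ refl
unit-range { -[1+ suc n ]} () _

*2≢-1 : ∀ t → ¬ (t ℤ.* + 2 ≡ -1ℤ)
*2≢-1 (+ zero) ()
*2≢-1 (+ suc n) ()
*2≢-1 -[1+ n ] ()

module AxisSegment {a b : ℤ} (a≤0 : a ≤ + 0) (0<b : + 0 < b) where

  a<b : a < b
  a<b = ℤₚ.≤-<-trans a≤0 0<b

  origin∈ : ∀ {m} (rest : Vec PtZ m) → InConv (axis a ∷ axis b ∷ rest) (toQ (axis (+ 0)))
  origin∈ rest = axis-point-mem {j = + 0} rest a<b a≤0 (ℤₚ.<⇒≤ 0<b)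

  e₃∈ : ∀ {m} (rest : Vec PtZ m) → InConv (axis a ∷ axis b ∷ rest) (toQ (axis (+ 1)))
  e₃∈ rest = axis-point-mem {j = + 1} rest a<b (ℤₚ.≤-trans a≤0 (+≤+ z≤n)) (1≤b 0<b)
    where
    1≤b : ∀ {b} → + 0 < b → + 1 ≤ b
    1≤b (+<+ 0<n) = +≤+ 0<n

axis-long-or-unit : ∀ {a b} → a ≤ + 0 → + 0 < b → (∃ λ k → b ℤ.- a ≡ + suc (suc k)) ⊎ (a ≡ + 0 × b ≡ + 1)
axis-long-or-unit {+ zero} {+ suc zero} _ _ = inj₂ (refl , refl)
axis-long-or-unit {+ zero} {+ suc (suc m)} _ _ = inj₁ (m ℕ.+ 0 , refl)
axis-long-or-unit { -[1+ n ]} {+ suc m} _ _ = inj₁ (m ℕ.+ n , cong (λ t → + suc t) (ℕₚ.+-suc m n))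
axis-long-or-unit {+ suc n} (+≤+ ()) _
axis-long-or-unit {_} {+ zero} _ (+<+ ())


-- The polytope F₁

g₁ A₁ B₁ C₁ : PtZ
g₁ = + 1 , -1ℤ , + 0
A₁ = pt -1ℤ -1ℤ (+ 0)
B₁ = pt (+ 2) -1ℤ (+ 1)
C₁ = pt -1ℤ (+ 2) -1ℤ

F1-lattice : ∀ {a b} u → LatticePt (F1 a b) u → + 3 ∣ g₁ · u
F1-lattice {a} {b} (x , y , z) p = [ on-axis , off-axis ]′ axis-weighted-or-not
  where
  open AxisBarycentric (F1 a b) (x , y , z) p
  1-x-y : Affine
  1-x-y = (-1ℤ , -1ℤ , + 0) , + 1
  1-x-y⟨⟩ : 1-x-y ⟨ x , y , z ⟩ ≡ ℤ.- (x ℤ.+ y) ℤ.+ + 1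
  1-x-y⟨⟩ = lemma x y z
    where
    lemma : ∀ x y z → -1ℤ ℤ.* x ℤ.+ -1ℤ ℤ.* y ℤ.+ + 0 ℤ.* z ℤ.+ + 1 ≡ ℤ.- (x ℤ.+ y) ℤ.+ + 1
    lemma = solve-∀
  on-axis : AxisWeighted → + 3 ∣ g₁ · (x , y , z)
  on-axis w>0 = subst₂ (λ x y → + 3 ∣ g₁ · (x , y , z)) (sym (proj₁ x≡0∧y≡0)) (sym (proj₂ x≡0∧y≡0))
                  (divides (+ 0) refl)
    where
    x≡0∧y≡0 : x ≡ + 0 × y ≡ + 0
    x≡0∧y≡0 = origin-of-cone
      (0<t+1⇒0≤t (subst (+ 0 <_) x+1⟨ x , y , z ⟩
                   (affine-pos-axis w>0 x+1 (nonneg-by-evaluation (F1 a b) x+1) 0<1 0<1)))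
      (0<t+1⇒0≤t (subst (+ 0 <_) y+1⟨ x , y , z ⟩
                   (affine-pos-axis w>0 y+1 (nonneg-by-evaluation (F1 a b) y+1) 0<1 0<1)))
      (0<t+1⇒0≤t (subst (+ 0 <_) 1-x-y⟨⟩
                   (affine-pos-axis w>0 1-x-y (nonneg-by-evaluation (F1 a b) 1-x-y) 0<1 0<1)))
  off-axis : weight zero ≡ 0ℚ × weight (suc zero) ≡ 0ℚ → + 3 ∣ g₁ · (x , y , z)
  off-axis w≡0 = divisible-by-plane (+ 1) -1ℤ -1ℤ (+ 3) (x , y , z)
    (affine-zero-off-axis w≡0 ((+ 1 , -1ℤ , -[1+ 2 ]) , + 0) λ
      { zero → refl
      ; (suc zero) → refl
      ; (suc (suc zero)) → refl })

F1-only-zero-flat : ∀ {a b} → a < b → ∀ c → Flat (F1 a b) c → c ≡ 0Z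
F1-only-zero-flat {a} {b} a<b c@(c₁ , c₂ , c₃) flat = ≡-triple c₁≡0 c₂≡0 c₃≡0
  where
  cA≡0 : c · A₁ ≡ + 0
  cA≡0 = triple-flat (c · A₁) (c · B₁) (c · C₁) (·-sum-zero₃ c A₁ B₁ C₁ refl)
                     (flat (# 2) (# 3)) (flat (# 2) (# 4))
  cB≡0 : c · B₁ ≡ + 0
  cB≡0 = triple-flat (c · B₁) (c · A₁) (c · C₁) (·-sum-zero₃ c B₁ A₁ C₁ refl)
                     (flat (# 3) (# 2)) (flat (# 3) (# 4))
  ∣c₃∣≤1 : ∣ c₃ ∣ ℕ.≤ 1
  ∣c₃∣≤1 = ℕₚ.≤-trans (∣i∣≤∣i*j∣ c₃ (i<j⇒0<j-i a<b)) (axis-flat c a b (flat (# 1) (# 0)))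
  3c₁≡ : ∀ c₁ c₂ c₃ → c₁ ℤ.* + 3 ≡ ℤ.- c₃ ℤ.+ ((c₁ ℤ.* + 2 ℤ.+ c₂ ℤ.* -1ℤ ℤ.+ c₃ ℤ.* + 1)
                                              ℤ.- (c₁ ℤ.* -1ℤ ℤ.+ c₂ ℤ.* -1ℤ ℤ.+ c₃ ℤ.* + 0))
  3c₁≡ = solve-∀
  3c₁≡-c₃ : c₁ ℤ.* + 3 ≡ ℤ.- c₃
  3c₁≡-c₃ = begin
    c₁ ℤ.* + 3                          ≡⟨ 3c₁≡ c₁ c₂ c₃ ⟩
    ℤ.- c₃ ℤ.+ (c · B₁ ℤ.- c · A₁)         ≡⟨ cong₂ (λ s t → ℤ.- c₃ ℤ.+ (s ℤ.- t)) cB≡0 cA≡0 ⟩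
    ℤ.- c₃ ℤ.+ + 0                      ≡⟨ ℤₚ.+-identityʳ (ℤ.- c₃) ⟩
    ℤ.- c₃                              ∎
  c₁≡0 : c₁ ≡ + 0
  c₁≡0 = small-multiple≡0 c₁ 3 3c₁≡-c₃
           (s≤s (ℕₚ.≤-trans (ℕₚ.≤-reflexive (ℤₚ.∣-i∣≡∣i∣ c₃)) (ℕₚ.≤-trans ∣c₃∣≤1 (ℕₚ.n≤1+n 1))))
  c₃≡0 : c₃ ≡ + 0
  c₃≡0 = trans (sym (ℤₚ.neg-involutive c₃)) (cong ℤ.-_ (trans (sym 3c₁≡-c₃) (cong (ℤ._* + 3) c₁≡0)))
  c₂≡ : ∀ c₁ c₂ c₃ → c₂ ≡ ℤ.- (c₁ ℤ.* -1ℤ ℤ.+ c₂ ℤ.* -1ℤ ℤ.+ c₃ ℤ.* + 0) ℤ.- c₁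
  c₂≡ = solve-∀
  c₂≡0 : c₂ ≡ + 0
  c₂≡0 = trans (c₂≡ c₁ c₂ c₃) (cong₂ (λ s t → ℤ.- s ℤ.- t) cA≡0 c₁≡0)

F1-nonspanning : ∀ {a b} → a ≤ + 0 → + 0 < b → NonSpanningWide (F1 a b) 3
F1-nonspanning {a} {b} a≤0 0<b = dim , width , index , s≤s (s≤s z≤n)
  where
  open AxisSegment a≤0 0<b
  V = F1 a b
  O₀ O₁ : PtZ
  O₀ = axis (+ 0)
  O₁ = axis (+ 1)
  rest : Vec PtZ 3
  rest = A₁ ∷ B₁ ∷ C₁ ∷ []
  dim : Dim3 V
  dim = toQ A₁ , toQ B₁ , toQ C₁ , toQ O₁ ,
        vertex-mem V (# 2) , vertex-mem V (# 3) , vertex-mem V (# 4) , e₃∈ rest , λ ()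
  width : WidthGT1 V
  width = only-zero-flat⇒WidthGT1 V (F1-only-zero-flat a<b)
  index : Index V 3
  index = index-from-functional {S = LatticePt V} 3 -1ℤ (F1-lattice {a} {b})
    (add {u = B₁ -Z O₁} {v = O₀ -Z A₁} (diff {u = B₁} {v = O₁} (vertex-mem V (# 3)) (e₃∈ rest))
                                       (diff {u = O₀} {v = A₁} (origin∈ rest) (vertex-mem V (# 2))))
    (diff {u = O₀} {v = A₁} (origin∈ rest) (vertex-mem V (# 2)))
    (diff {u = O₁} {v = O₀} (e₃∈ rest) (origin∈ rest))


-- The polytopes F₂, F₃, F₄

-- F2 a b, F3 a b k and F4 a b are definitionally F2⁺ a b [], F2⁺ a b (D₃ k ∷ []) and
-- F2⁺ a b (D₄ ∷ []).
A₂ B₂ C₂ : PtZ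
A₂ = pt -1ℤ -1ℤ (+ 1)
B₂ = pt (+ 1) -1ℤ (+ 0)
C₂ = pt -1ℤ (+ 1) (+ 0)

F2⁺ : ∀ {m} → ℤ → ℤ → Vec PtZ m → Vec PtZ (5 ℕ.+ m)
F2⁺ a b rest = axis a ∷ axis b ∷ A₂ ∷ B₂ ∷ C₂ ∷ rest

D₃ : ℤ → PtZ
D₃ k = pt (+ 1) (+ 1) (+ 2 ℤ.* k ℤ.- + 1)

D₄ : PtZ
D₄ = pt (+ 3) -1ℤ -1ℤ

g₂ : PtZ
g₂ = + 1 , + 1 , + 0

F2⁺-off-axis : ∀ {m a b} (rest : Vec PtZ m) → (∀ i → ((+ 1 , + 1 , + 2) , + 0) ⟨ lookup rest i ⟩ ≡ + 0) →
  ∀ u (p : LatticePt (F2⁺ a b rest) u) → proj₁ p zero ≡ 0ℚ × proj₁ p (suc zero) ≡ 0ℚ → + 2 ∣ g₂ · u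
F2⁺-off-axis {a = a} {b} rest plane-on-rest u p w≡0 = divisible-by-plane (+ 1) (+ 1) (+ 1) (+ 2) u
  (affine-zero-off-axis w≡0 ((+ 1 , + 1 , + 2) , + 0) λ
    { zero → refl
    ; (suc zero) → refl
    ; (suc (suc zero)) → refl
    ; (suc (suc (suc i))) → plane-on-rest i })
  where
  open AxisBarycentric (F2⁺ a b rest) u p

F2-lattice : ∀ {a b} u → LatticePt (F2 a b) u → + 2 ∣ g₂ · u
F2-lattice {a} {b} (x , y , z) p =
  [ on-axis , F2⁺-off-axis {a = a} {b} [] (λ ()) (x , y , z) p ]′ axis-weighted-or-not
  where
  open AxisBarycentric (F2 a b) (x , y , z) p
  -x-y : Affine
  -x-y = (-1ℤ , -1ℤ , + 0) , + 0
  -x-y⟨⟩ : -x-y ⟨ x , y , z ⟩ ≡ ℤ.- (x ℤ.+ y)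
  -x-y⟨⟩ = lemma x y z
    where
    lemma : ∀ x y z → -1ℤ ℤ.* x ℤ.+ -1ℤ ℤ.* y ℤ.+ + 0 ℤ.* z ℤ.+ + 0 ≡ ℤ.- (x ℤ.+ y)
    lemma = solve-∀
  on-axis : AxisWeighted → + 2 ∣ g₂ · (x , y , z)
  on-axis w>0 = subst₂ (λ x y → + 2 ∣ g₂ · (x , y , z)) (sym (proj₁ x≡0∧y≡0)) (sym (proj₂ x≡0∧y≡0))
                  (divides (+ 0) refl)
    where
    x≡0∧y≡0 : x ≡ + 0 × y ≡ + 0
    x≡0∧y≡0 = origin-of-cone
      (0<t+1⇒0≤t (subst (+ 0 <_) x+1⟨ x , y , z ⟩
                   (affine-pos-axis w>0 x+1 (nonneg-by-evaluation (F2 a b) x+1) 0<1 0<1)))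
      (0<t+1⇒0≤t (subst (+ 0 <_) y+1⟨ x , y , z ⟩
                   (affine-pos-axis w>0 y+1 (nonneg-by-evaluation (F2 a b) y+1) 0<1 0<1)))
      (subst (+ 0 ≤_) -x-y⟨⟩ (affine-nonneg -x-y (nonneg-by-evaluation (F2 a b) -x-y)))

F4-lattice : ∀ {a b} u → LatticePt (F4 a b) u → + 2 ∣ g₂ · u
F4-lattice {a} {b} (x , y , z) p =
  [ on-axis , F2⁺-off-axis {a = a} {b} (D₄ ∷ []) (λ { zero → refl }) (x , y , z) p ]′ axis-weighted-or-not
  where
  open AxisBarycentric (F4 a b) (x , y , z) p
  1-x-2y : Affine
  1-x-2y = (-1ℤ , -[1+ 1 ] , + 0) , + 1
  1-x-2y⟨⟩ : 1-x-2y ⟨ x , y , z ⟩ ≡ ℤ.- (x ℤ.+ (y ℤ.+ y)) ℤ.+ + 1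
  1-x-2y⟨⟩ = lemma x y z
    where
    lemma : ∀ x y z → -1ℤ ℤ.* x ℤ.+ -[1+ 1 ] ℤ.* y ℤ.+ + 0 ℤ.* z ℤ.+ + 1 ≡ ℤ.- (x ℤ.+ (y ℤ.+ y)) ℤ.+ + 1
    lemma = solve-∀
  double≡0 : ∀ {t} → t ℤ.+ t ≡ + 0 → t ≡ + 0
  double≡0 {+ zero} _ = refl
  on-axis : AxisWeighted → + 2 ∣ g₂ · (x , y , z)
  on-axis w>0 = subst₂ (λ x y → + 2 ∣ g₂ · (x , y , z)) (sym (proj₁ x≡0∧2y≡0)) (sym (double≡0 (proj₂ x≡0∧2y≡0)))
                  (divides (+ 0) refl)
    where
    y≥0 : + 0 ≤ y
    y≥0 = 0<t+1⇒0≤t (subst (+ 0 <_) y+1⟨ x , y , z ⟩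
                       (affine-pos-axis w>0 y+1 (nonneg-by-evaluation (F4 a b) y+1) 0<1 0<1))
    x≡0∧2y≡0 : x ≡ + 0 × y ℤ.+ y ≡ + 0
    x≡0∧2y≡0 = origin-of-cone
      (0<t+1⇒0≤t (subst (+ 0 <_) x+1⟨ x , y , z ⟩
                   (affine-pos-axis w>0 x+1 (nonneg-by-evaluation (F4 a b) x+1) 0<1 0<1)))
      (ℤₚ.+-mono-≤ y≥0 y≥0)
      (0<t+1⇒0≤t (subst (+ 0 <_) 1-x-2y⟨⟩
                   (affine-pos-axis w>0 1-x-2y (nonneg-by-evaluation (F4 a b) 1-x-2y) 0<1 0<1)))

F3-square : ∀ {a b k} x y z → LatticePt (F3 a b k) (x , y , z) →
  (x ≡ -1ℤ ⊎ x ≡ + 0 ⊎ x ≡ + 1) × (y ≡ -1ℤ ⊎ y ≡ + 0 ⊎ y ≡ + 1)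
F3-square {a} {b} {k} x y z p =
  unit-range (bound x+1 x+1⟨ x , y , z ⟩) (bound 1-x 1-x⟨ x , y , z ⟩) ,
  unit-range (bound y+1 y+1⟨ x , y , z ⟩) (bound 1-y 1-y⟨ x , y , z ⟩)
  where
  open Barycentric (F3 a b k) (x , y , z) p
  bound : ∀ h {t} → h ⟨ x , y , z ⟩ ≡ t → {True (Finₚ.all? λ i → + 0 ℤₚ.≤? h ⟨ lookup (F3 a b k) i ⟩)} → + 0 ≤ t
  bound h h⟨u⟩≡t {h≥0} = subst (+ 0 ≤_) h⟨u⟩≡t (affine-nonneg h (nonneg-by-evaluation (F3 a b k) h {h≥0}))

2z≢2k-1 : ∀ z k → z ℤ.* + 2 ≢ + 2 ℤ.* k ℤ.- + 1
2z≢2k-1 z k 2z≡2k-1 = *2≢-1 (z ℤ.- k) (begin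
  (z ℤ.- k) ℤ.* + 2                         ≡⟨ distrib z k ⟩
  z ℤ.* + 2 ℤ.- + 2 ℤ.* k                    ≡⟨ cong (ℤ._- + 2 ℤ.* k) 2z≡2k-1 ⟩
  (+ 2 ℤ.* k ℤ.- + 1) ℤ.- + 2 ℤ.* k          ≡⟨ cancel k ⟩
  -1ℤ                                       ∎)
  where
  distrib : ∀ z k → (z ℤ.- k) ℤ.* + 2 ≡ z ℤ.* + 2 ℤ.- + 2 ℤ.* k
  distrib = solve-∀
  cancel : ∀ k → (+ 2 ℤ.* k ℤ.- + 1) ℤ.- + 2 ℤ.* k ≡ -1ℤ
  cancel = solve-∀

-- In each lemma below the face of F3 a b k on which h vanishes is an edge, φ vanishes at both
-- of its endpoints, and at the given point φ would be 2z minus an odd number.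

F3-no-point-at-x+ : ∀ {a b k z} → ¬ LatticePt (F3 a b k) (+ 1 , + 0 , z)
F3-no-point-at-x+ {a} {b} {k} {z} p = 2z≢2k-1 z k (ℤₚ.i-j≡0⇒i≡j _ _ (trans (sym (φ-at-u K z)) φ≡0))
  where
  open Barycentric (F3 a b k) (+ 1 , + 0 , z) p
  K = + 2 ℤ.* k ℤ.- + 1
  φ : Affine
  φ = (+ 0 , ℤ.- K , + 2) , ℤ.- K
  φ-at-u : ∀ K z → + 0 ℤ.* + 1 ℤ.+ ℤ.- K ℤ.* + 0 ℤ.+ + 2 ℤ.* z ℤ.+ ℤ.- K ≡ z ℤ.* + 2 ℤ.- K
  φ-at-u = solve-∀
  φ-at-B : ∀ K → + 0 ℤ.* + 1 ℤ.+ ℤ.- K ℤ.* -1ℤ ℤ.+ + 2 ℤ.* + 0 ℤ.+ ℤ.- K ≡ + 0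
  φ-at-B = solve-∀
  φ-at-D : ∀ K → + 0 ℤ.* + 1 ℤ.+ ℤ.- K ℤ.* + 1 ℤ.+ + 2 ℤ.* K ℤ.+ ℤ.- K ≡ + 0
  φ-at-D = solve-∀
  φ≡0 : φ ⟨ + 1 , + 0 , z ⟩ ≡ + 0
  φ≡0 = vanish-on-face 1-x (nonneg-by-evaluation (F3 a b k) 1-x) refl φ λ
    { zero → inj₁ 0<1
    ; (suc zero) → inj₁ 0<1
    ; (suc (suc zero)) → inj₁ 0<2
    ; (suc (suc (suc zero))) → inj₂ (φ-at-B K)
    ; (suc (suc (suc (suc zero)))) → inj₁ 0<2
    ; (suc (suc (suc (suc (suc zero))))) → inj₂ (φ-at-D K) }

F3-no-point-at-x- : ∀ {a b k z} → ¬ LatticePt (F3 a b k) (-1ℤ , + 0 , z)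
F3-no-point-at-x- {a} {b} {k} {z} p = 2z≢2k-1 z (+ 1) (ℤₚ.i-j≡0⇒i≡j _ _ (trans (sym (φ-at-u z)) φ≡0))
  where
  open Barycentric (F3 a b k) (-1ℤ , + 0 , z) p
  φ : Affine
  φ = (+ 0 , + 1 , + 2) , -1ℤ
  φ-at-u : ∀ z → + 0 ℤ.* -1ℤ ℤ.+ + 1 ℤ.* + 0 ℤ.+ + 2 ℤ.* z ℤ.+ -1ℤ ≡ z ℤ.* + 2 ℤ.- + 1
  φ-at-u = solve-∀
  φ≡0 : φ ⟨ -1ℤ , + 0 , z ⟩ ≡ + 0
  φ≡0 = vanish-on-face x+1 (nonneg-by-evaluation (F3 a b k) x+1) refl φ λ
    { zero → inj₁ 0<1
    ; (suc zero) → inj₁ 0<1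
    ; (suc (suc zero)) → inj₂ refl
    ; (suc (suc (suc zero))) → inj₁ 0<2
    ; (suc (suc (suc (suc zero)))) → inj₂ refl
    ; (suc (suc (suc (suc (suc zero))))) → inj₁ 0<2 }

F3-no-point-at-y+ : ∀ {a b k z} → ¬ LatticePt (F3 a b k) (+ 0 , + 1 , z)
F3-no-point-at-y+ {a} {b} {k} {z} p = 2z≢2k-1 z k (ℤₚ.i-j≡0⇒i≡j _ _ (trans (sym (φ-at-u K z)) φ≡0))
  where
  open Barycentric (F3 a b k) (+ 0 , + 1 , z) p
  K = + 2 ℤ.* k ℤ.- + 1
  φ : Affine
  φ = (ℤ.- K , + 0 , + 2) , ℤ.- K
  φ-at-u : ∀ K z → ℤ.- K ℤ.* + 0 ℤ.+ + 0 ℤ.* + 1 ℤ.+ + 2 ℤ.* z ℤ.+ ℤ.- K ≡ z ℤ.* + 2 ℤ.- K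
  φ-at-u = solve-∀
  φ-at-C : ∀ K → ℤ.- K ℤ.* -1ℤ ℤ.+ + 0 ℤ.* + 1 ℤ.+ + 2 ℤ.* + 0 ℤ.+ ℤ.- K ≡ + 0
  φ-at-C = solve-∀
  φ-at-D : ∀ K → ℤ.- K ℤ.* + 1 ℤ.+ + 0 ℤ.* + 1 ℤ.+ + 2 ℤ.* K ℤ.+ ℤ.- K ≡ + 0
  φ-at-D = solve-∀
  φ≡0 : φ ⟨ + 0 , + 1 , z ⟩ ≡ + 0
  φ≡0 = vanish-on-face 1-y (nonneg-by-evaluation (F3 a b k) 1-y) refl φ λ
    { zero → inj₁ 0<1
    ; (suc zero) → inj₁ 0<1
    ; (suc (suc zero)) → inj₁ 0<2
    ; (suc (suc (suc zero))) → inj₁ 0<2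
    ; (suc (suc (suc (suc zero)))) → inj₂ (φ-at-C K)
    ; (suc (suc (suc (suc (suc zero))))) → inj₂ (φ-at-D K) }

F3-no-point-at-y- : ∀ {a b k z} → ¬ LatticePt (F3 a b k) (+ 0 , -1ℤ , z)
F3-no-point-at-y- {a} {b} {k} {z} p = 2z≢2k-1 z (+ 1) (ℤₚ.i-j≡0⇒i≡j _ _ (trans (sym (φ-at-u z)) φ≡0))
  where
  open Barycentric (F3 a b k) (+ 0 , -1ℤ , z) p
  φ : Affine
  φ = (+ 1 , + 0 , + 2) , -1ℤ
  φ-at-u : ∀ z → + 1 ℤ.* + 0 ℤ.+ + 0 ℤ.* -1ℤ ℤ.+ + 2 ℤ.* z ℤ.+ -1ℤ ≡ z ℤ.* + 2 ℤ.- + 1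
  φ-at-u = solve-∀
  φ≡0 : φ ⟨ + 0 , -1ℤ , z ⟩ ≡ + 0
  φ≡0 = vanish-on-face y+1 (nonneg-by-evaluation (F3 a b k) y+1) refl φ λ
    { zero → inj₁ 0<1
    ; (suc zero) → inj₁ 0<1
    ; (suc (suc zero)) → inj₂ refl
    ; (suc (suc (suc zero))) → inj₂ refl
    ; (suc (suc (suc (suc zero)))) → inj₁ 0<2
    ; (suc (suc (suc (suc (suc zero))))) → inj₁ 0<2 }

even-on-square : ∀ {x y} z → (x ≡ -1ℤ ⊎ x ≡ + 0 ⊎ x ≡ + 1) × (y ≡ -1ℤ ⊎ y ≡ + 0 ⊎ y ≡ + 1) →
  ¬ (x ≡ -1ℤ × y ≡ + 0) → ¬ (x ≡ + 1 × y ≡ + 0) → ¬ (x ≡ + 0 × y ≡ -1ℤ) → ¬ (x ≡ + 0 × y ≡ + 1) →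
  + 2 ∣ g₂ · (x , y , z)
even-on-square z (inj₁ refl , inj₁ refl) _ _ _ _ = divides -1ℤ refl
even-on-square z (inj₁ refl , inj₂ (inj₁ refl)) ¬x- _ _ _ = ⊥-elim (¬x- (refl , refl))
even-on-square z (inj₁ refl , inj₂ (inj₂ refl)) _ _ _ _ = divides (+ 0) refl
even-on-square z (inj₂ (inj₁ refl) , inj₁ refl) _ _ ¬y- _ = ⊥-elim (¬y- (refl , refl))
even-on-square z (inj₂ (inj₁ refl) , inj₂ (inj₁ refl)) _ _ _ _ = divides (+ 0) refl
even-on-square z (inj₂ (inj₁ refl) , inj₂ (inj₂ refl)) _ _ _ ¬y+ = ⊥-elim (¬y+ (refl , refl))
even-on-square z (inj₂ (inj₂ refl) , inj₁ refl) _ _ _ _ = divides (+ 0) refl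
even-on-square z (inj₂ (inj₂ refl) , inj₂ (inj₁ refl)) _ ¬x+ _ _ = ⊥-elim (¬x+ (refl , refl))
even-on-square z (inj₂ (inj₂ refl) , inj₂ (inj₂ refl)) _ _ _ _ = divides (+ 1) refl

F3-lattice : ∀ {a b k} u → LatticePt (F3 a b k) u → + 2 ∣ g₂ · u
F3-lattice {a} {b} {k} (x , y , z) p = even-on-square z (F3-square {a} {b} {k} x y z p)
  (λ (x≡-1 , y≡0) → F3-no-point-at-x- {a} {b} {k} {z} (p-at x≡-1 y≡0))
  (λ (x≡1 , y≡0) → F3-no-point-at-x+ {a} {b} {k} {z} (p-at x≡1 y≡0))
  (λ (x≡0 , y≡-1) → F3-no-point-at-y- {a} {b} {k} {z} (p-at x≡0 y≡-1))
  (λ (x≡0 , y≡1) → F3-no-point-at-y+ {a} {b} {k} {z} (p-at x≡0 y≡1))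
  where
  p-at : ∀ {x′ y′} → x ≡ x′ → y ≡ y′ → LatticePt (F3 a b k) (x′ , y′ , z)
  p-at x≡ y≡ = subst₂ (λ x y → LatticePt (F3 a b k) (x , y , z)) x≡ y≡ p

module F2⁺-flatness {m a b} (rest : Vec PtZ m) (c₁ c₂ c₃ : ℤ) (flat : Flat (F2⁺ a b rest) (c₁ , c₂ , c₃)) where

  c : PtZ
  c = c₁ , c₂ , c₃

  cB≡0 : c · B₂ ≡ + 0
  cB≡0 = pair-flat (c · B₂) (c · C₂) (·-sum-zero₂ c B₂ C₂ refl) (flat (# 3) (# 4))

  2c₁≡[cB-cA]+c₃ : c₁ ℤ.* + 2 ≡ (c · B₂ ℤ.- c · A₂) ℤ.+ c₃
  2c₁≡[cB-cA]+c₃ = lemma c₁ c₂ c₃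
    where
    lemma : ∀ c₁ c₂ c₃ → c₁ ℤ.* + 2 ≡ ((c₁ ℤ.* + 1 ℤ.+ c₂ ℤ.* -1ℤ ℤ.+ c₃ ℤ.* + 0)
                                         ℤ.- (c₁ ℤ.* -1ℤ ℤ.+ c₂ ℤ.* -1ℤ ℤ.+ c₃ ℤ.* + 1)) ℤ.+ c₃
    lemma = solve-∀

  c₂≡0 : c₁ ≡ + 0 → c₂ ≡ + 0
  c₂≡0 c₁≡0 = trans (lemma c₁ c₂ c₃) (cong₂ ℤ._-_ c₁≡0 cB≡0)
    where
    lemma : ∀ c₁ c₂ c₃ → c₂ ≡ c₁ ℤ.- (c₁ ℤ.* + 1 ℤ.+ c₂ ℤ.* -1ℤ ℤ.+ c₃ ℤ.* + 0)
    lemma = solve-∀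

F2⁺-only-zero-flat-long : ∀ {m a b k} (rest : Vec PtZ m) → b ℤ.- a ≡ + suc (suc k) →
  ∀ c → Flat (F2⁺ a b rest) c → c ≡ 0Z
F2⁺-only-zero-flat-long {a = a} {b} {k} rest b-a≡2+k (c₁ , c₂ , c₃) flat = ≡-triple c₁≡0 (c₂≡0 c₁≡0) c₃≡0
  where
  open F2⁺-flatness rest c₁ c₂ c₃ flat
  c₃≡0 : c₃ ≡ + 0
  c₃≡0 = small-multiple≡0 c₃ (suc (suc k)) (cong (c₃ ℤ.*_) (sym b-a≡2+k))
           (s≤s (ℕₚ.≤-trans (axis-flat c a b (flat (# 1) (# 0))) (s≤s z≤n)))
  2c₁≡cB-cA : c₁ ℤ.* + 2 ≡ c · B₂ ℤ.- c · A₂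
  2c₁≡cB-cA = begin
    c₁ ℤ.* + 2                      ≡⟨ 2c₁≡[cB-cA]+c₃ ⟩
    (c · B₂ ℤ.- c · A₂) ℤ.+ c₃         ≡⟨ cong (λ t → (c · B₂ ℤ.- c · A₂) ℤ.+ t) c₃≡0 ⟩
    (c · B₂ ℤ.- c · A₂) ℤ.+ + 0        ≡⟨ ℤₚ.+-identityʳ (c · B₂ ℤ.- c · A₂) ⟩
    c · B₂ ℤ.- c · A₂                  ∎
  c₁≡0 : c₁ ≡ + 0
  c₁≡0 = small-multiple≡0 c₁ 2 2c₁≡cB-cA (s≤s (flat (# 3) (# 2)))

F2⁺-only-zero-flat-if-A : ∀ {m a b} (rest : Vec PtZ m) → a < b →
  ∀ c → Flat (F2⁺ a b rest) c → c · A₂ ≡ + 0 → c ≡ 0Z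
F2⁺-only-zero-flat-if-A {a = a} {b} rest a<b (c₁ , c₂ , c₃) flat cA≡0 = ≡-triple c₁≡0 (c₂≡0 c₁≡0) c₃≡0
  where
  open F2⁺-flatness rest c₁ c₂ c₃ flat
  2c₁≡c₃ : c₁ ℤ.* + 2 ≡ c₃
  2c₁≡c₃ = begin
    c₁ ℤ.* + 2                      ≡⟨ 2c₁≡[cB-cA]+c₃ ⟩
    (c · B₂ ℤ.- c · A₂) ℤ.+ c₃         ≡⟨ cong₂ (λ s t → (s ℤ.- t) ℤ.+ c₃) cB≡0 cA≡0 ⟩
    + 0 ℤ.+ c₃                      ≡⟨ ℤₚ.+-identityˡ c₃ ⟩
    c₃                              ∎
  c₁≡0 : c₁ ≡ + 0
  c₁≡0 = small-multiple≡0 c₁ 2 2c₁≡c₃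
           (s≤s (ℕₚ.≤-trans (∣i∣≤∣i*j∣ c₃ (i<j⇒0<j-i a<b)) (axis-flat c a b (flat (# 1) (# 0)))))
  c₃≡0 : c₃ ≡ + 0
  c₃≡0 = trans (sym 2c₁≡c₃) (cong (ℤ._* + 2) c₁≡0)

F2⁺-nonspanning : ∀ {m a b} (rest : Vec PtZ m) → a ≤ + 0 → + 0 < b →
  (∀ c → Flat (F2⁺ a b rest) c → c ≡ 0Z) → (∀ u → LatticePt (F2⁺ a b rest) u → + 2 ∣ g₂ · u) →
  NonSpanningWide (F2⁺ a b rest) 2
F2⁺-nonspanning {a = a} {b} rest a≤0 0<b flat⇒0 lattice = dim , width , index , s≤s (s≤s z≤n)
  where
  open AxisSegment a≤0 0<b
  V = F2⁺ a b rest
  O₀ O₁ : PtZ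
  O₀ = axis (+ 0)
  O₁ = axis (+ 1)
  rest′ = A₂ ∷ B₂ ∷ C₂ ∷ rest
  dim : Dim3 V
  dim = toQ A₂ , toQ B₂ , toQ C₂ , toQ O₁ ,
        vertex-mem V (# 2) , vertex-mem V (# 3) , vertex-mem V (# 4) , e₃∈ rest′ , λ ()
  width : WidthGT1 V
  width = only-zero-flat⇒WidthGT1 V flat⇒0
  index : Index V 2
  index = index-from-functional {S = LatticePt V} 2 (+ 1) lattice
    (add {u = B₂ -Z O₀} {v = O₁ -Z A₂} (diff {u = B₂} {v = O₀} (vertex-mem V (# 3)) (origin∈ rest′))
                                     (diff {u = O₁} {v = A₂} (e₃∈ rest′) (vertex-mem V (# 2))))
    (diff {u = C₂} {v = O₀} (vertex-mem V (# 4)) (origin∈ rest′))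
    (diff {u = O₁} {v = O₀} (e₃∈ rest′) (origin∈ rest′))

F2-nonspanning : ∀ {a b} → a ≤ + 0 → + 0 < b → ¬ ((a , b) ≡ (+ 0 , + 1)) → NonSpanningWide (F2 a b) 2
F2-nonspanning {a} {b} a≤0 0<b ab≢01 with axis-long-or-unit a≤0 0<b
... | inj₁ (_ , b-a≡2+k) = F2⁺-nonspanning [] a≤0 0<b (F2⁺-only-zero-flat-long [] b-a≡2+k) (F2-lattice {a} {b})
... | inj₂ (refl , refl) = ⊥-elim (ab≢01 refl)

F3-nonspanning : ∀ {a b} k → a ≤ + 0 → + 0 < b → + 0 ≤ k → k ≤ b → ¬ ((a , b , k) ≡ (+ 0 , + 1 , + 1)) →
  NonSpanningWide (F3 a b k) 2
F3-nonspanning {a} {b} k a≤0 0<b 0≤k k≤b abk≢011 with axis-long-or-unit a≤0 0<b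
... | inj₁ (_ , b-a≡2+k) =
  F2⁺-nonspanning (D₃ k ∷ []) a≤0 0<b (F2⁺-only-zero-flat-long (D₃ k ∷ []) b-a≡2+k) (F3-lattice {a} {b} {k})
... | inj₂ (refl , refl) with k≡0 0≤k k≤b abk≢011
  where
  k≡0 : ∀ {k} → + 0 ≤ k → k ≤ + 1 → ¬ ((+ 0 , + 1 , k) ≡ (+ 0 , + 1 , + 1)) → k ≡ + 0
  k≡0 {+ zero} _ _ _ = refl
  k≡0 {+ suc zero} _ _ k≢1 = ⊥-elim (k≢1 refl)
  k≡0 {+ suc (suc n)} _ (+≤+ (s≤s ()))
... | refl = F2⁺-nonspanning (D₃ (+ 0) ∷ []) a≤0 0<b flat⇒0 (F3-lattice {+ 0} {+ 1} {+ 0})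
  where
  flat⇒0 : ∀ c → Flat (F3 (+ 0) (+ 1) (+ 0)) c → c ≡ 0Z
  flat⇒0 c flat = F2⁺-only-zero-flat-if-A (D₃ (+ 0) ∷ []) (+<+ (s≤s z≤n)) c flat
    (pair-flat (c · A₂) (c · D₃ (+ 0)) (·-sum-zero₂ c A₂ (D₃ (+ 0)) refl) (flat (# 2) (# 5)))

F4-nonspanning : ∀ {a b} → a ≤ + 0 → + 0 < b → NonSpanningWide (F4 a b) 2
F4-nonspanning {a} {b} a≤0 0<b with axis-long-or-unit a≤0 0<b
... | inj₁ (_ , b-a≡2+k) =
  F2⁺-nonspanning (D₄ ∷ []) a≤0 0<b (F2⁺-only-zero-flat-long (D₄ ∷ []) b-a≡2+k) (F4-lattice {a} {b})
... | inj₂ (refl , refl) = F2⁺-nonspanning (D₄ ∷ []) a≤0 0<b flat⇒0 (F4-lattice {+ 0} {+ 1})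
  where
  flat⇒0 : ∀ c → Flat (F4 (+ 0) (+ 1)) c → c ≡ 0Z
  flat⇒0 c@(c₁ , c₂ , c₃) flat = F2⁺-only-zero-flat-if-A (D₄ ∷ []) (+<+ (s≤s z≤n)) c flat
    (pair-flat (c · A₂) (c · D₄) cA+cD≡0 (flat (# 2) (# 5)))
    where
    open F2⁺-flatness (D₄ ∷ []) c₁ c₂ c₃ flat using (cB≡0)
    cA+cD≡0 : c · A₂ ℤ.+ c · D₄ ≡ + 0
    cA+cD≡0 = begin
      c · A₂ ℤ.+ c · D₄   ≡⟨ sym (·-+Z c A₂ D₄) ⟩
      c · (B₂ +Z B₂)      ≡⟨ ·-+Z c B₂ B₂ ⟩
      c · B₂ ℤ.+ c · B₂   ≡⟨ cong₂ ℤ._+_ cB≡0 cB≡0 ⟩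
      + 0               ∎


lemma1p2 : (a b : ℤ) → a ≤ + 0 → + 0 < b →
    NonSpanningWide (F1 a b) 3
    × (¬ ((a , b) ≡ (+ 0 , + 1)) → NonSpanningWide (F2 a b) 2)
    × (∀ (k : ℤ) → + 0 ≤ k → k ≤ b → ¬ ((a , b , k) ≡ (+ 0 , + 1 , + 1)) →
         NonSpanningWide (F3 a b k) 2)
    × NonSpanningWide (F4 a b) 2
lemma1p2 a b a≤0 0<b =
  F1-nonspanning a≤0 0<b ,
  F2-nonspanning a≤0 0<b ,
  (λ k → F3-nonspanning k a≤0 0<b) ,
  F4-nonspanning a≤0 0<b
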